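{- Every group of order $24$ which is generated by elements of odd order is isomorphic to the binary tetrahedral group $\tilde A_4$.
   Context: $\tilde A_4=\langle\alpha,\beta\mid\alpha^3=\beta^3=(\alpha\beta)^2\rangle\cong SL_2(\mathbb F_3)$. -}

module Defs where

open import Level using (Level; _⊔_) renaming (zero to 0ℓ)
open import Data.Nat using (ℕ; zero; suc; _<_; _%_)
open import Data.Fin using (Fin)
open import Data.Product using (Σ; ∃; _×_; _,_; proj₁; proj₂)
open import Relation.Nullary using (¬_)
open import Relation.Binary.PropositionalEquality
  using (_≡_; refl; sym; trans; cong; cong₂; isEquivalence)
import Relation.Binary.PropositionalEquality as ≡
open import Algebra.Bundles using (Group; RawGroup; CommutativeRing)
open import Algebra.Structures using (IsCommutativeRing)
open import Algebra.Morphism.Structures using (module GroupMorphisms)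
open import Function.Bundles using (Bijection)
open import Data.Maybe using (just; nothing)
open import Tactic.RingSolver using (solve-∀)
open import Tactic.RingSolver.Core.AlmostCommutativeRing using (AlmostCommutativeRing; fromCommutativeRing)

module _ {c ℓ : Level} (G : Group c ℓ) where
  open Group G

  pow : Carrier → ℕ → Carrier
  pow g zero    = ε
  pow g (suc n) = g ∙ pow g n

  HasOrder : Carrier → ℕ → Set ℓ
  HasOrder g n = 0 < n × pow g n ≈ ε × (∀ m → 0 < m → m < n → ¬ (pow g m ≈ ε))

  HasOddOrder : Carrier → Set ℓ
  HasOddOrder g = ∃ λ n → HasOrder g n × n % 2 ≡ 1

  data ⟨_⟩ {p : Level} (S : Carrier → Set p) : Carrier → Set (c ⊔ ℓ ⊔ p) where
    gen  : ∀ {x} → S x → ⟨ S ⟩ x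
    unit : ⟨ S ⟩ ε
    mul  : ∀ {x y} → ⟨ S ⟩ x → ⟨ S ⟩ y → ⟨ S ⟩ (x ∙ y)
    inv  : ∀ {x} → ⟨ S ⟩ x → ⟨ S ⟩ (x ⁻¹)
    resp : ∀ {x y} → x ≈ y → ⟨ S ⟩ x → ⟨ S ⟩ y

  GeneratedBy : {p : Level} → (Carrier → Set p) → Set (c ⊔ ℓ ⊔ p)
  GeneratedBy S = ∀ g → ⟨ S ⟩ g

  HasOrderℕ : ℕ → Set (c ⊔ ℓ)
  HasOrderℕ n = Bijection setoid (≡.setoid (Fin n))

  IsomorphicTo : {b ℓ₂ : Level} → RawGroup b ℓ₂ → Set (c ⊔ ℓ ⊔ b ⊔ ℓ₂)
  IsomorphicTo H = ∃ λ (f : Carrier → RawGroup.Carrier H) →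
    GroupMorphisms.IsGroupIsomorphism rawGroup H f

-- The field F₃ = {0,1,2} (written o, i, t)

data F3 : Set where
  o i t : F3

infixl 6 _+₃_
infixl 7 _*₃_
_+₃_ : F3 → F3 → F3
o +₃ o = o
o +₃ i = i
o +₃ t = t
i +₃ o = i
i +₃ i = t
i +₃ t = o
t +₃ o = t
t +₃ i = o
t +₃ t = i

_*₃_ : F3 → F3 → F3
o *₃ o = o
o *₃ i = o
o *₃ t = o
i *₃ o = o
i *₃ i = i
i *₃ t = t
t *₃ o = o
t *₃ i = t
t *₃ t = i

-₃_ : F3 → F3
-₃ o = o
-₃ i = t
-₃ t = i
F3+-assoc : ∀ x y z → (x +₃ y) +₃ z ≡ x +₃ (y +₃ z)
F3+-assoc o o o = refl
F3+-assoc o o i = refl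
F3+-assoc o o t = refl
F3+-assoc o i o = refl
F3+-assoc o i i = refl
F3+-assoc o i t = refl
F3+-assoc o t o = refl
F3+-assoc o t i = refl
F3+-assoc o t t = refl
F3+-assoc i o o = refl
F3+-assoc i o i = refl
F3+-assoc i o t = refl
F3+-assoc i i o = refl
F3+-assoc i i i = refl
F3+-assoc i i t = refl
F3+-assoc i t o = refl
F3+-assoc i t i = refl
F3+-assoc i t t = refl
F3+-assoc t o o = refl
F3+-assoc t o i = refl
F3+-assoc t o t = refl
F3+-assoc t i o = refl
F3+-assoc t i i = refl
F3+-assoc t i t = refl
F3+-assoc t t o = refl
F3+-assoc t t i = refl
F3+-assoc t t t = refl

F3*-assoc : ∀ x y z → (x *₃ y) *₃ z ≡ x *₃ (y *₃ z)
F3*-assoc o o o = refl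
F3*-assoc o o i = refl
F3*-assoc o o t = refl
F3*-assoc o i o = refl
F3*-assoc o i i = refl
F3*-assoc o i t = refl
F3*-assoc o t o = refl
F3*-assoc o t i = refl
F3*-assoc o t t = refl
F3*-assoc i o o = refl
F3*-assoc i o i = refl
F3*-assoc i o t = refl
F3*-assoc i i o = refl
F3*-assoc i i i = refl
F3*-assoc i i t = refl
F3*-assoc i t o = refl
F3*-assoc i t i = refl
F3*-assoc i t t = refl
F3*-assoc t o o = refl
F3*-assoc t o i = refl
F3*-assoc t o t = refl
F3*-assoc t i o = refl
F3*-assoc t i i = refl
F3*-assoc t i t = refl
F3*-assoc t t o = refl
F3*-assoc t t i = refl
F3*-assoc t t t = refl

F3-distribʳ : ∀ x y z → (y +₃ z) *₃ x ≡ (y *₃ x) +₃ (z *₃ x)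
F3-distribʳ o o o = refl
F3-distribʳ o o i = refl
F3-distribʳ o o t = refl
F3-distribʳ o i o = refl
F3-distribʳ o i i = refl
F3-distribʳ o i t = refl
F3-distribʳ o t o = refl
F3-distribʳ o t i = refl
F3-distribʳ o t t = refl
F3-distribʳ i o o = refl
F3-distribʳ i o i = refl
F3-distribʳ i o t = refl
F3-distribʳ i i o = refl
F3-distribʳ i i i = refl
F3-distribʳ i i t = refl
F3-distribʳ i t o = refl
F3-distribʳ i t i = refl
F3-distribʳ i t t = refl
F3-distribʳ t o o = refl
F3-distribʳ t o i = refl
F3-distribʳ t o t = refl
F3-distribʳ t i o = refl
F3-distribʳ t i i = refl
F3-distribʳ t i t = refl
F3-distribʳ t t o = refl
F3-distribʳ t t i = refl
F3-distribʳ t t t = refl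

F3+-comm : ∀ x y → x +₃ y ≡ y +₃ x
F3+-comm o o = refl
F3+-comm o i = refl
F3+-comm o t = refl
F3+-comm i o = refl
F3+-comm i i = refl
F3+-comm i t = refl
F3+-comm t o = refl
F3+-comm t i = refl
F3+-comm t t = refl

F3*-comm : ∀ x y → x *₃ y ≡ y *₃ x
F3*-comm o o = refl
F3*-comm o i = refl
F3*-comm o t = refl
F3*-comm i o = refl
F3*-comm i i = refl
F3*-comm i t = refl
F3*-comm t o = refl
F3*-comm t i = refl
F3*-comm t t = refl

F3+-idˡ : ∀ x → o +₃ x ≡ x
F3+-idˡ o = refl
F3+-idˡ i = refl
F3+-idˡ t = refl

F3*-idˡ : ∀ x → i *₃ x ≡ x
F3*-idˡ o = refl
F3*-idˡ i = refl
F3*-idˡ t = refl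

F3*-zeroˡ : ∀ x → o *₃ x ≡ o
F3*-zeroˡ o = refl
F3*-zeroˡ i = refl
F3*-zeroˡ t = refl

F3-invˡ : ∀ x → (-₃ x) +₃ x ≡ o
F3-invˡ o = refl
F3-invˡ i = refl
F3-invˡ t = refl


F3-commutativeRing : CommutativeRing 0ℓ 0ℓ
F3-commutativeRing = record
  { Carrier = F3 ; _≈_ = _≡_ ; _+_ = _+₃_ ; _*_ = _*₃_ ; -_ = -₃_ ; 0# = o ; 1# = i
  ; isCommutativeRing = record
    { isRing = record
      { +-isAbelianGroup = record
        { isGroup = record
          { isMonoid = record
            { isSemigroup = record
              { isMagma = record { isEquivalence = isEquivalence ; ∙-cong = cong₂ _+₃_ }
              ; assoc = F3+-assoc }
            ; identity = F3+-idˡ , λ x → trans (F3+-comm x o) (F3+-idˡ x) }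
          ; inverse = F3-invˡ , λ x → trans (F3+-comm x (-₃ x)) (F3-invˡ x)
          ; ⁻¹-cong = cong -₃_ }
        ; comm = F3+-comm }
      ; *-cong = cong₂ _*₃_
      ; *-assoc = F3*-assoc
      ; *-identity = F3*-idˡ , λ x → trans (F3*-comm x i) (F3*-idˡ x)
      ; distrib = (λ x y z → trans (F3*-comm x (y +₃ z))
                     (trans (F3-distribʳ x y z) (cong₂ _+₃_ (F3*-comm y x) (F3*-comm z x))))
                , F3-distribʳ }
    ; *-comm = F3*-comm } }

record M2 : Set where
  constructor mat
  field a b c d : F3

_·_ : M2 → M2 → M2
mat a b c d · mat e f g h =
  mat (a *₃ e +₃ b *₃ g) (a *₃ f +₃ b *₃ h) (c *₃ e +₃ d *₃ g) (c *₃ f +₃ d *₃ h)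

det : M2 → F3
det (mat a b c d) = a *₃ d +₃ -₃ (b *₃ c)

-- adjugate (= inverse when det = 1)
adj : M2 → M2
adj (mat a b c d) = mat d (-₃ b) (-₃ c) a

I2 : M2
I2 = mat i o o i

F3-ring : AlmostCommutativeRing 0ℓ 0ℓ
F3-ring = fromCommutativeRing F3-commutativeRing (λ { o → just refl ; i → nothing ; t → nothing })

det-· : ∀ a b c d e f g h →
  (a *₃ e +₃ b *₃ g) *₃ (c *₃ f +₃ d *₃ h) +₃ -₃ ((a *₃ f +₃ b *₃ h) *₃ (c *₃ e +₃ d *₃ g))
    ≡ (a *₃ d +₃ -₃ (b *₃ c)) *₃ (e *₃ h +₃ -₃ (f *₃ g))
det-· = solve-∀ F3-ring

det-adj : ∀ a b c d → d *₃ a +₃ -₃ ((-₃ b) *₃ (-₃ c)) ≡ a *₃ d +₃ -₃ (b *₃ c)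
det-adj = solve-∀ F3-ring

det-mult : ∀ m n → det (m · n) ≡ det m *₃ det n
det-mult (mat a b c d) (mat e f g h) = det-· a b c d e f g h

det-adj' : ∀ m → det (adj m) ≡ det m
det-adj' (mat a b c d) = det-adj a b c d

SL₂F₃ : Set
SL₂F₃ = Σ M2 (λ m → det m ≡ i)

SL₂F₃-rawGroup : RawGroup 0ℓ 0ℓ
SL₂F₃-rawGroup = record
  { Carrier = SL₂F₃
  ; _≈_     = λ x y → proj₁ x ≡ proj₁ y
  ; _∙_     = λ { (m , p) (n , q) → m · n , trans (det-mult m n) (cong₂ _*₃_ p q) }
  ; ε       = I2 , refl
  ; _⁻¹     = λ { (m , p) → adj m , trans (det-adj' m) p }
  }

-- The binary tetrahedral group  Ã₄ = ⟨α, β ∣ α³ = β³ = (αβ)²⟩ ≅ SL₂(F₃)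

binaryTetrahedral : RawGroup 0ℓ 0ℓ
binaryTetrahedral = SL₂F₃-rawGroup

module Submission where

-- A group G of order 24 generated by elements of odd order has no subgroup of index 2 (a
-- homomorphism onto ℤ/2 would kill every generator), its elements of odd order have order 1 or 3,
-- and any two distinct subgroups of order 3 generate it, since a subgroup containing both has at
-- least 9 elements. Counting orbits of conjugation and inversion, together with a double count
-- against the normaliser of a subgroup ⟨a⟩ of order 3 (all such subgroups being conjugate, by a
-- double-coset count), shows that G has exactly eight elements of order 3, hence four subgroups of
-- order 3, which G permutes by conjugation. The kernel of this action has at most two elements and
-- is central, and reading off the action gives generators a and x′ with a³ = (a x′)³ = x′⁴ = 1 and
-- x′² central. Two matrices α, ξ of SL₂(𝔽₃) satisfy the same relations; each of the 24 elements is
-- given as a word in α and ξ, and for every such normal form w and generator s an explicit chain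
-- of relation steps rewrites w s into the normal form of the product. Evaluating normal forms at
-- a and x′ is therefore a homomorphism SL₂(𝔽₃) → G; it is onto because a and x′ generate G, hence
-- bijective.

module Counting where

  open import Data.Nat.Base using (ℕ; zero; suc; _+_; _*_; _≤_; _<_; z≤n; s≤s)
  open import Data.Nat.Properties
    using (+-0-commutativeMonoid; +-suc; +-identityʳ; *-distribʳ-+; +-mono-≤; +-monoʳ-≤; +-monoˡ-≤;
           ≤-refl; ≤-reflexive; ≤-trans; ≤-pred; n≤1+n; m≤n+m; m<m+n; <-irrefl; module ≤-Reasoning)
  open import Data.Nat.Divisibility using (_∣_; ∣m∣n⇒∣m+n; ∣-refl) renaming (_∣0 to _∣zero)
  open import Data.Fin.Base using (Fin; zero; suc; combine; remQuot)
  open import Data.Fin.Properties using (_≟_; suc-injective; remQuot-combine; combine-remQuot)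
  open import Data.Fin.Permutation using (permutation)
  open import Data.Bool.Base using (Bool; true; false; _∧_; _∨_; not)
  open import Data.Bool.Properties using (¬-not; ∧-zeroʳ; ∧-identityʳ)
  open import Data.Product using (∃; ∃₂; _×_; _,_; proj₁; proj₂; uncurry)
  open import Data.Sum using (_⊎_; inj₁; inj₂; [_,_])
  open import Data.Empty using (⊥-elim)
  open import Relation.Nullary using (¬_; yes; no; does)
  open import Relation.Nullary.Decidable using (dec-true; dec-false)
  open import Relation.Binary.PropositionalEquality hiding ([_])
  import Algebra.Properties.CommutativeMonoid.Sum as Sum
  open Sum +-0-commutativeMonoid using (sum; sum-permute; ∑-comm; sum-cong-≗)

  true≢false : true ≢ false
  true≢false ()

  indicator : Bool → ℕ
  indicator true  = 1
  indicator false = 0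

  infix 4 _==_
  _==_ : ∀ {n} → Fin n → Fin n → Bool
  x == y = does (x ≟ y)

  ==⇒≡ : ∀ {n} {x y : Fin n} → (x == y) ≡ true → x ≡ y
  ==⇒≡ {x = x} {y} h with x ≟ y
  ... | yes p = p

  ≡⇒== : ∀ {n} {x y : Fin n} → x ≡ y → (x == y) ≡ true
  ≡⇒== {x = x} {y} = dec-true (x ≟ y)

  ==-refl : ∀ {n} (x : Fin n) → (x == x) ≡ true
  ==-refl x = ≡⇒== {x = x} refl

  ≢⇒==false : ∀ {n} {x y : Fin n} → x ≢ y → (x == y) ≡ false
  ≢⇒==false {x = x} {y} = dec-false (x ≟ y)

  ≡-stable : ∀ {n} {x y : Fin n} → ¬ x ≢ y → x ≡ y
  ≡-stable {x = x} {y} ¬x≢y with x == y in e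
  ... | true  = ==⇒≡ e
  ... | false = ⊥-elim (¬x≢y λ x≡y → true≢false (trans (sym (≡⇒== x≡y)) e))

  ==-sym : ∀ {n} (x y : Fin n) → (x == y) ≡ (y == x)
  ==-sym x y with x ≟ y | y ≟ x
  ... | yes _ | yes _ = refl
  ... | no  _ | no  _ = refl
  ... | yes p | no ¬q = ⊥-elim (¬q (sym p))
  ... | no ¬p | yes q = ⊥-elim (¬p (sym q))

  bool-ext : ∀ {a b : Bool} → (a ≡ true → b ≡ true) → (b ≡ true → a ≡ true) → a ≡ b
  bool-ext {false} {false} _ _ = refl
  bool-ext {false} {true}  _ g = g refl
  bool-ext {true}          f _ = sym (f refl)

  ∧-intro : ∀ {a b} → a ≡ true → b ≡ true → a ∧ b ≡ true
  ∧-intro refl refl = refl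

  ∧-elim : ∀ {a b} → a ∧ b ≡ true → a ≡ true × b ≡ true
  ∧-elim {true} {true} _ = refl , refl

  ∧-≡ʳ : ∀ {a b} → (b ≡ true → a ≡ true) → a ∧ b ≡ b
  ∧-≡ʳ {a} {false} _ = ∧-zeroʳ a
  ∧-≡ʳ {a} {true}  h = trans (∧-identityʳ a) (h refl)

  ∨-introˡ : ∀ {a} b → a ≡ true → a ∨ b ≡ true
  ∨-introˡ b refl = refl

  ∨-introʳ : ∀ a {b} → b ≡ true → a ∨ b ≡ true
  ∨-introʳ true  _ = refl
  ∨-introʳ false h = h

  ∨-elim : ∀ {a b} → a ∨ b ≡ true → a ≡ true ⊎ b ≡ true
  ∨-elim {true}  _ = inj₁ refl
  ∨-elim {false} h = inj₂ h

  not-intro : ∀ {b} → b ≡ false → not b ≡ true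
  not-intro refl = refl

  not-elim : ∀ {b} → not b ≡ true → b ≡ false
  not-elim {false} _ = refl

  search : ∀ {n} (P : Fin n → Bool) → (∃ λ i → P i ≡ true) ⊎ (∀ i → P i ≡ false)
  search {zero}  P = inj₂ (λ ())
  search {suc n} P with P zero in eq
  ... | true = inj₁ (zero , eq)
  ... | false with search (λ i → P (suc i))
  ...   | inj₁ (i , h) = inj₁ (suc i , h)
  ...   | inj₂ h       = inj₂ λ { zero → eq ; (suc i) → h i }

  any : ∀ {n} → (Fin n → Bool) → Bool
  any {zero}  P = false
  any {suc n} P = P zero ∨ any (λ i → P (suc i))

  any-intro : ∀ {n} (P : Fin n → Bool) i → P i ≡ true → any P ≡ true
  any-intro P zero    h = ∨-introˡ _ h
  any-intro P (suc i) h = ∨-introʳ (P zero) (any-intro (λ j → P (suc j)) i h)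

  any-elim : ∀ {n} (P : Fin n → Bool) → any P ≡ true → ∃ λ i → P i ≡ true
  any-elim {suc n} P h with ∨-elim {P zero} h
  ... | inj₁ h₀ = zero , h₀
  ... | inj₂ hs with any-elim (λ i → P (suc i)) hs
  ...   | i , hi = suc i , hi

  all : ∀ {n} → (Fin n → Bool) → Bool
  all P = not (any (λ i → not (P i)))

  all-elim : ∀ {n} (P : Fin n → Bool) → all P ≡ true → ∀ i → P i ≡ true
  all-elim P h i with P i in eq
  ... | true  = refl
  ... | false = ⊥-elim (true≢false (trans (sym (any-intro (λ j → not (P j)) i (not-intro eq))) (not-elim h)))

  opaque
    count : ∀ {n} → (Fin n → Bool) → ℕ
    count P = sum (λ i → indicator (P i))

    count-[] : ∀ (P : Fin 0 → Bool) → count P ≡ 0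
    count-[] P = refl

    count-∷ : ∀ {n} (P : Fin (suc n) → Bool) → count P ≡ indicator (P zero) + count (λ i → P (suc i))
    count-∷ P = refl

    count-cong : ∀ {n} {P Q : Fin n → Bool} → (∀ i → P i ≡ Q i) → count P ≡ count Q
    count-cong P≗Q = sum-cong-≗ (λ i → cong indicator (P≗Q i))

    count-permute : ∀ {n} (P : Fin n → Bool) (f g : Fin n → Fin n) →
      (∀ y → f (g y) ≡ y) → (∀ x → g (f x) ≡ x) → count (λ i → P (f i)) ≡ count P
    count-permute P f g fg gf = sym (sum-permute (λ i → indicator (P i)) (permutation f g fg gf))

    count-comm : ∀ {m n} (M : Fin m → Fin n → Bool) →
      sum (λ t → count (M t)) ≡ sum (λ x → count (λ t → M t x))
    count-comm M = ∑-comm (λ t x → indicator (M t x))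

  sum-const : ∀ {n} (g : Fin n → ℕ) {c} → (∀ x → g x ≡ c) → sum g ≡ n * c
  sum-const {zero}  g h = refl
  sum-const {suc n} g h = cong₂ _+_ (h zero) (sum-const (λ i → g (suc i)) (λ i → h (suc i)))

  sum-on : ∀ {n} (P : Fin n → Bool) (g : Fin n → ℕ) {c} →
    (∀ t → P t ≡ true → g t ≡ c) → (∀ t → P t ≡ false → g t ≡ 0) → sum g ≡ count P * c
  sum-on {zero}  P g h₁ h₀ = cong (_* _) (sym (count-[] P))
  sum-on {suc n} P g {c} h₁ h₀ =
    trans (cong₂ _+_ (head (P zero) refl) (sum-on (λ i → P (suc i)) (λ i → g (suc i)) (λ i → h₁ (suc i)) (λ i → h₀ (suc i))))
          (trans (sym (*-distribʳ-+ c (indicator (P zero)) _)) (cong (_* c) (sym (count-∷ P))))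
    where
    head : ∀ b → P zero ≡ b → g zero ≡ indicator b * c
    head true  eq = trans (h₁ zero eq) (sym (+-identityʳ c))
    head false eq = h₀ zero eq

  double-count : ∀ {m n} (M : Fin m → Fin n → Bool) (P : Fin m → Bool) {r c} →
    (∀ t → P t ≡ true → count (M t) ≡ r) → (∀ t → P t ≡ false → count (M t) ≡ 0) →
    (∀ x → count (λ t → M t x) ≡ c) → count P * r ≡ n * c
  double-count M P rows empty-rows columns =
    trans (sym (sum-on P (λ t → count (M t)) rows empty-rows))
          (trans (count-comm M) (sum-const (λ x → count (λ t → M t x)) columns))

  count-mono : ∀ {n} {P Q : Fin n → Bool} → (∀ i → P i ≡ true → Q i ≡ true) → count P ≤ count Q
  count-mono {zero} {P} {Q} _ = ≤-reflexive (trans (count-[] P) (sym (count-[] Q)))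
  count-mono {suc n} {P} {Q} P⊆Q = begin
    count P                                      ≡⟨ count-∷ P ⟩
    indicator (P zero) + count (λ i → P (suc i)) ≤⟨ +-mono-≤ (head (P zero) (Q zero) (P⊆Q zero)) (count-mono (λ i → P⊆Q (suc i))) ⟩
    indicator (Q zero) + count (λ i → Q (suc i)) ≡⟨ count-∷ Q ⟨
    count Q                                      ∎
    where
    open ≤-Reasoning
    head : ∀ p q → (p ≡ true → q ≡ true) → indicator p ≤ indicator q
    head false q _ = z≤n
    head true  q h rewrite h refl = ≤-refl

  count-true : ∀ n → count {n} (λ _ → true) ≡ n
  count-true zero    = count-[] _
  count-true (suc n) = trans (count-∷ _) (cong suc (count-true n))

  count-false : ∀ {n} (P : Fin n → Bool) → (∀ i → P i ≡ false) → count P ≡ 0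
  count-false {zero}  P _ = count-[] P
  count-false {suc n} P h rewrite count-∷ P | h zero = count-false (λ i → P (suc i)) (λ i → h (suc i))

  count-≤-size : ∀ {n} (P : Fin n → Bool) → count P ≤ n
  count-≤-size {n} P = subst (count P ≤_) (count-true n) (count-mono (λ _ _ → refl))

  count-pos : ∀ {n} (P : Fin n → Bool) i → P i ≡ true → 1 ≤ count P
  count-pos P zero    h rewrite count-∷ P | h = s≤s z≤n
  count-pos P (suc i) h rewrite count-∷ P = ≤-trans (count-pos (λ j → P (suc j)) i h) (m≤n+m _ (indicator (P zero)))

  count-∧-split : ∀ {n} (P Q : Fin n → Bool) →
    count P ≡ count (λ i → P i ∧ Q i) + count (λ i → P i ∧ not (Q i))
  count-∧-split {zero} P Q rewrite count-[] P | count-[] (λ i → P i ∧ Q i) | count-[] (λ i → P i ∧ not (Q i)) = refl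
  count-∧-split {suc n} P Q
    rewrite count-∷ P | count-∷ (λ i → P i ∧ Q i) | count-∷ (λ i → P i ∧ not (Q i)) =
    trans (cong (indicator (P zero) +_) (count-∧-split (λ i → P (suc i)) (λ i → Q (suc i))))
          (head (P zero) (Q zero) _ _)
    where
    head : ∀ p q x y → indicator p + (x + y) ≡ (indicator (p ∧ q) + x) + (indicator (p ∧ not q) + y)
    head false q    x y = refl
    head true  true x y = refl
    head true false x y = sym (+-suc x y)

  count-∨-disjoint : ∀ {n} (P Q : Fin n → Bool) → (∀ i → P i ≡ true → Q i ≡ false) →
    count (λ i → P i ∨ Q i) ≡ count P + count Q
  count-∨-disjoint {zero} P Q _ rewrite count-[] (λ i → P i ∨ Q i) | count-[] P | count-[] Q = refl
  count-∨-disjoint {suc n} P Q h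
    rewrite count-∷ (λ i → P i ∨ Q i) | count-∷ P | count-∷ Q =
    trans (cong (indicator (P zero ∨ Q zero) +_) (count-∨-disjoint (λ i → P (suc i)) (λ i → Q (suc i)) (λ i → h (suc i))))
          (head (P zero) (Q zero) (h zero) _ _)
    where
    head : ∀ p q → (p ≡ true → q ≡ false) → ∀ x y →
      indicator (p ∨ q) + (x + y) ≡ (indicator p + x) + (indicator q + y)
    head false false _ x y = refl
    head false true  _ x y = sym (+-suc x y)
    head true  false _ x y = refl
    head true  true  k x y with k refl
    ... | ()

  count-∨-≤ : ∀ {n} (P Q : Fin n → Bool) → count (λ i → P i ∨ Q i) ≤ count P + count Q
  count-∨-≤ {zero} P Q rewrite count-[] (λ i → P i ∨ Q i) = z≤n
  count-∨-≤ {suc n} P Q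
    rewrite count-∷ (λ i → P i ∨ Q i) | count-∷ P | count-∷ Q =
    ≤-trans (+-monoʳ-≤ (indicator (P zero ∨ Q zero)) (count-∨-≤ (λ i → P (suc i)) (λ i → Q (suc i))))
            (head (P zero) (Q zero) _ _)
    where
    head : ∀ p q x y → indicator (p ∨ q) + (x + y) ≤ (indicator p + x) + (indicator q + y)
    head false false x y = ≤-refl
    head false true  x y = ≤-reflexive (sym (+-suc x y))
    head true  false x y = ≤-refl
    head true  true  x y = s≤s (+-monoʳ-≤ x (n≤1+n y))

  count-not : ∀ {n} (P : Fin n → Bool) → count P + count (λ i → not (P i)) ≡ n
  count-not {zero} P rewrite count-[] P | count-[] (λ i → not (P i)) = refl
  count-not {suc n} P rewrite count-∷ P | count-∷ (λ i → not (P i)) =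
    trans (head (P zero) _ _) (cong suc (count-not (λ i → P (suc i))))
    where
    head : ∀ b x y → (indicator b + x) + (indicator (not b) + y) ≡ suc (x + y)
    head false x y = +-suc x y
    head true  x y = refl

  count<size⇒false : ∀ {n} (P : Fin n → Bool) → count P < n → ∃ λ i → P i ≡ false
  count<size⇒false {n} P lt with search (λ i → not (P i))
  ... | inj₁ (i , h) = i , not-elim h
  ... | inj₂ h = ⊥-elim (<-irrefl refl (≤-trans lt (subst (_≤ count P) (count-true n)
                   (count-mono (λ i _ → not-false (h i))))))
    where
    not-false : ∀ {b} → not b ≡ false → b ≡ true
    not-false {true} _ = refl

  ⊆∧count-≥⇒⊇ : ∀ {n} (P Q : Fin n → Bool) → (∀ i → P i ≡ true → Q i ≡ true) →
    count Q ≤ count P → ∀ i → Q i ≡ true → P i ≡ true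
  ⊆∧count-≥⇒⊇ P Q P⊆Q Q≤P i qi with P i in pi
  ... | true  = refl
  ... | false = ⊥-elim (<-irrefl refl (≤-trans P<Q Q≤P))
    where
    QP≡P : count (λ j → Q j ∧ P j) ≡ count P
    QP≡P = count-cong λ j → ∧-≡ʳ (P⊆Q j)
    witness : 1 ≤ count (λ j → Q j ∧ not (P j))
    witness = count-pos (λ j → Q j ∧ not (P j)) i (∧-intro qi (not-intro pi))
    P<Q : count P < count Q
    P<Q = begin-strict
      count P                                           <⟨ m<m+n (count P) witness ⟩
      count P + count (λ j → Q j ∧ not (P j))           ≡⟨ cong (_+ count (λ j → Q j ∧ not (P j))) QP≡P ⟨
      count (λ j → Q j ∧ P j) + count (λ j → Q j ∧ not (P j)) ≡⟨ count-∧-split Q P ⟨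
      count Q                                           ∎
      where open ≤-Reasoning

  count≥size⇒all : ∀ {n} (P : Fin n → Bool) → n ≤ count P → ∀ i → P i ≡ true
  count≥size⇒all {n} P le i =
    ⊆∧count-≥⇒⊇ P (λ _ → true) (λ _ _ → refl) (subst (_≤ count P) (sym (count-true n)) le) i refl

  count-== : ∀ {n} (x : Fin n) → count (λ y → y == x) ≡ 1
  count-== {suc n} zero = trans (count-∷ (λ y → y == zero))
    (cong suc (count-false (λ y → suc y == zero) (λ y → ≢⇒==false {x = suc y} {zero} (λ ()))))
  count-== {suc n} (suc x) = trans (count-∷ (λ y → y == suc x)) (count-== x)

  opaque
    image : ∀ {m n} → (Fin m → Fin n) → Fin n → Bool
    image f y = any (λ i → f i == y)

    image-intro : ∀ {m n} (f : Fin m → Fin n) i {y} → f i ≡ y → image f y ≡ true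
    image-intro f i eq = any-intro (λ j → f j == _) i (≡⇒== eq)

    image-elim : ∀ {m n} (f : Fin m → Fin n) {y} → image f y ≡ true → ∃ λ i → f i ≡ y
    image-elim f h with any-elim (λ i → f i == _) h
    ... | i , hi = i , ==⇒≡ hi

    count-image-injective : ∀ {m n} (f : Fin m → Fin n) → (∀ i j → f i ≡ f j → i ≡ j) → count (image f) ≡ m
    count-image-injective {zero}  f _ = count-false (image f) (λ _ → refl)
    count-image-injective {suc m} f inj =
      trans (count-∨-disjoint (λ y → f zero == y) (image (λ i → f (suc i))) disjoint)
            (cong₂ _+_ (trans (count-cong (λ y → ==-sym (f zero) y)) (count-== (f zero)))
                       (count-image-injective (λ i → f (suc i)) (λ i j e → suc-injective (inj (suc i) (suc j) e))))
      where
      disjoint : ∀ y → (f zero == y) ≡ true → image (λ i → f (suc i)) y ≡ false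
      disjoint y h = ¬-not λ h′ → let (i , fi≡y) = image-elim (λ i → f (suc i)) h′ in
        (zero≢suc (inj zero (suc i) (trans (==⇒≡ h) (sym fi≡y))))
        where
        zero≢suc : ∀ {i : Fin m} → zero ≢ suc i
        zero≢suc ()

    count-image-≤ : ∀ {m n} (f : Fin m → Fin n) → count (image f) ≤ m
    count-image-≤ {zero}  f = ≤-reflexive (count-false (image f) (λ _ → refl))
    count-image-≤ {suc m} f = begin
      count (image f)                                                   ≤⟨ count-∨-≤ (λ y → f zero == y) (image (λ i → f (suc i))) ⟩
      count (λ y → f zero == y) + count (image (λ i → f (suc i)))       ≡⟨ cong (_+ count (image (λ i → f (suc i)))) (trans (count-cong (λ y → ==-sym (f zero) y)) (count-== (f zero))) ⟩
      suc (count (image (λ i → f (suc i))))                             ≤⟨ s≤s (count-image-≤ (λ i → f (suc i))) ⟩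
      suc m                                                             ∎
      where open ≤-Reasoning

    image₂ : ∀ {a b n} → (Fin a → Fin b → Fin n) → Fin n → Bool
    image₂ {a} {b} f = image (λ k → uncurry f (remQuot {a} b k))

    image₂-intro : ∀ {a b n} (f : Fin a → Fin b → Fin n) i j {y} → f i j ≡ y → image₂ f y ≡ true
    image₂-intro {a} {b} f i j eq =
      image-intro (λ k → uncurry f (remQuot {a} b k)) (combine i j) (trans (cong (uncurry f) (remQuot-combine i j)) eq)

    image₂-elim : ∀ {a b n} (f : Fin a → Fin b → Fin n) {y} → image₂ f y ≡ true → ∃₂ λ i j → f i j ≡ y
    image₂-elim {a} {b} f h with image-elim (λ k → uncurry f (remQuot {a} b k)) h
    ... | k , eq = proj₁ (remQuot {a} b k) , proj₂ (remQuot {a} b k) , eq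

    count-image₂-injective : ∀ {a b n} (f : Fin a → Fin b → Fin n) →
      (∀ i j k l → f i j ≡ f k l → i ≡ k × j ≡ l) → count (image₂ f) ≡ a * b
    count-image₂-injective {a} {b} f inj = count-image-injective (λ k → uncurry f (remQuot {a} b k)) remQuot-injective
      where
      remQuot-injective : ∀ k l → uncurry f (remQuot {a} b k) ≡ uncurry f (remQuot {a} b l) → k ≡ l
      remQuot-injective k l eq with inj _ _ _ _ eq
      ... | i≡ , j≡ = begin
        k                              ≡⟨ combine-remQuot {a} b k ⟨
        uncurry combine (remQuot {a} b k)  ≡⟨ cong₂ combine i≡ j≡ ⟩
        uncurry combine (remQuot {a} b l)  ≡⟨ combine-remQuot {a} b l ⟩
        l                              ∎
        where open ≡-Reasoning

  module _ {n : ℕ} (B : Fin n → Fin n → Bool) (k : ℕ) where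

    uniform-partition⇒∣count : ∀ (fuel : ℕ) (R : Fin n → Bool) → count R ≤ fuel →
      (∀ x → R x ≡ true → B x x ≡ true) →
      (∀ x y → R x ≡ true → B x y ≡ true → R y ≡ true) →
      (∀ x y z → R x ≡ true → B x y ≡ true → B y z ≡ B x z) →
      (∀ x → R x ≡ true → count (B x) ≡ k) →
      k ∣ count R
    uniform-partition⇒∣count fuel R le refl′ closed same size with search R
    ... | inj₂ none rewrite count-false R none = k ∣zero
    uniform-partition⇒∣count zero R le refl′ closed same size | inj₁ (x₀ , rx₀) =
      ⊥-elim (<-irrefl refl (≤-trans (count-pos R x₀ rx₀) le))
    uniform-partition⇒∣count (suc fuel) R le refl′ closed same size | inj₁ (x₀ , rx₀) =
      subst (k ∣_) (sym R≡class+rest) (∣m∣n⇒∣m+n ∣-refl rest-divisible)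
      where
      rest : Fin n → Bool
      rest y = R y ∧ not (B x₀ y)
      class-size : count (λ y → R y ∧ B x₀ y) ≡ k
      class-size = trans (count-cong (λ y → ∧-≡ʳ (closed x₀ y rx₀))) (size x₀ rx₀)
      R≡class+rest : count R ≡ k + count rest
      R≡class+rest = trans (count-∧-split R (B x₀)) (cong (_+ count rest) class-size)
      k≥1 : 1 ≤ k
      k≥1 = subst (1 ≤_) (size x₀ rx₀) (count-pos (B x₀) x₀ (refl′ x₀ rx₀))
      rest≤fuel : count rest ≤ fuel
      rest≤fuel = ≤-pred (≤-trans (+-monoˡ-≤ (count rest) k≥1) (≤-trans (≤-reflexive (sym R≡class+rest)) le))
      rest-elim : ∀ {x} → rest x ≡ true → R x ≡ true × B x₀ x ≡ false
      rest-elim {x} h with ∧-elim {R x} h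
      ... | rx , nb = rx , not-elim nb
      rest-closed : ∀ x y → rest x ≡ true → B x y ≡ true → rest y ≡ true
      rest-closed x y h bxy with rest-elim h
      ... | rx , b₀x = ∧-intro (closed x y rx bxy) (not-intro (¬-not λ b₀y →
        true≢false (trans (sym (refl′ x rx))
          (trans (sym (same x y x rx bxy)) (trans (same x₀ y x rx₀ b₀y) b₀x)))))
      rest-divisible : k ∣ count rest
      rest-divisible = uniform-partition⇒∣count fuel rest rest≤fuel
        (λ x h → refl′ x (proj₁ (rest-elim h)))
        rest-closed
        (λ x y z h → same x y z (proj₁ (rest-elim h)))
        (λ x h → size x (proj₁ (rest-elim h)))

  count-pair : ∀ {n} {x y : Fin n} → x ≢ y → count (λ z → (z == x) ∨ (z == y)) ≡ 2
  count-pair {x = x} {y} x≢y =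
    trans (count-∨-disjoint (λ z → z == x) (λ z → z == y) (λ z h → ≢⇒==false {x = z} {y} (λ z≡y → x≢y (trans (sym (==⇒≡ {x = z} {x} h)) z≡y))))
          (cong₂ _+_ (count-== x) (count-== y))

  count-triple : ∀ {n} {x y z : Fin n} → x ≢ y → x ≢ z → y ≢ z →
    count (λ w → (w == x) ∨ ((w == y) ∨ (w == z))) ≡ 3
  count-triple {x = x} {y} {z} x≢y x≢z y≢z =
    trans (count-∨-disjoint (λ w → w == x) (λ w → (w == y) ∨ (w == z)) disjoint)
          (cong₂ _+_ (count-== x) (count-pair y≢z))
    where
    disjoint : ∀ w → (w == x) ≡ true → (w == y) ∨ (w == z) ≡ false
    disjoint w h with ==⇒≡ {x = w} {x} h
    ... | refl rewrite ≢⇒==false x≢y | ≢⇒==false x≢z = refl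

  module _ {n} (σ : Fin n → Fin n) (R : Fin n → Bool)
           (R-σ : ∀ {x} → R x ≡ true → R (σ x) ≡ true)
           (no-fixed-point : ∀ {x} → R x ≡ true → σ x ≢ x) where

    involution⇒2∣count : (∀ x → σ (σ x) ≡ x) → 2 ∣ count R
    involution⇒2∣count σ²≡id =
      uniform-partition⇒∣count orbit 2 (suc (count R)) R (n≤1+n _)
        (λ x _ → ∨-introˡ _ (==-refl x)) orbit-closed (λ x y z _ → orbit-trans x y z)
        (λ x rx → count-pair (λ x≡σx → no-fixed-point rx (sym x≡σx)))
      where
      orbit : Fin n → Fin n → Bool
      orbit x y = (y == x) ∨ (y == σ x)
      orbit-elim : ∀ x y → orbit x y ≡ true → y ≡ x ⊎ y ≡ σ x
      orbit-elim x y h with ∨-elim {y == x} h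
      ... | inj₁ e = inj₁ (==⇒≡ e)
      ... | inj₂ e = inj₂ (==⇒≡ e)
      orbit-intro : ∀ x y → y ≡ x ⊎ y ≡ σ x → orbit x y ≡ true
      orbit-intro x y (inj₁ e) = ∨-introˡ _ (≡⇒== e)
      orbit-intro x y (inj₂ e) = ∨-introʳ (y == x) (≡⇒== e)
      orbit-closed : ∀ x y → R x ≡ true → orbit x y ≡ true → R y ≡ true
      orbit-closed x y rx h with orbit-elim x y h
      ... | inj₁ refl = rx
      ... | inj₂ refl = R-σ rx
      orbit-trans : ∀ x y z → orbit x y ≡ true → orbit y z ≡ orbit x z
      orbit-trans x y z h with orbit-elim x y h
      ... | inj₁ refl = refl
      ... | inj₂ refl = bool-ext
        (λ h′ → orbit-intro x z ([ inj₂ , (λ e → inj₁ (trans e (σ²≡id x))) ] (orbit-elim (σ x) z h′)))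
        (λ h′ → orbit-intro (σ x) z ([ (λ e → inj₂ (trans e (sym (σ²≡id x)))) , inj₁ ] (orbit-elim x z h′)))

    order3⇒3∣count : (∀ x → σ (σ (σ x)) ≡ x) → 3 ∣ count R
    order3⇒3∣count σ³≡id =
      uniform-partition⇒∣count orbit 3 (suc (count R)) R (n≤1+n _)
        (λ x _ → ∨-introˡ _ (==-refl x)) orbit-closed (λ x y z _ → orbit-trans x y z)
        (λ x rx → count-triple
           (λ x≡σx → no-fixed-point rx (sym x≡σx))
           (λ x≡σσx → no-fixed-point rx (trans (cong σ x≡σσx) (σ³≡id x)))
           (λ σx≡σσx → no-fixed-point rx (trans σx≡σσx (trans (cong σ σx≡σσx) (σ³≡id x)))))
      where
      Orbit : Fin n → Fin n → Set
      Orbit x y = y ≡ x ⊎ y ≡ σ x ⊎ y ≡ σ (σ x)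
      orbit : Fin n → Fin n → Bool
      orbit x y = (y == x) ∨ ((y == σ x) ∨ (y == σ (σ x)))
      orbit-elim : ∀ x y → orbit x y ≡ true → Orbit x y
      orbit-elim x y h with ∨-elim {y == x} h
      ... | inj₁ e = inj₁ (==⇒≡ e)
      ... | inj₂ h′ with ∨-elim {y == σ x} h′
      ...   | inj₁ e = inj₂ (inj₁ (==⇒≡ e))
      ...   | inj₂ e = inj₂ (inj₂ (==⇒≡ e))
      orbit-intro : ∀ x y → Orbit x y → orbit x y ≡ true
      orbit-intro x y (inj₁ e)        = ∨-introˡ _ (≡⇒== e)
      orbit-intro x y (inj₂ (inj₁ e)) = ∨-introʳ (y == x) (∨-introˡ _ (≡⇒== e))
      orbit-intro x y (inj₂ (inj₂ e)) = ∨-introʳ (y == x) (∨-introʳ (y == σ x) (≡⇒== e))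
      orbit-closed : ∀ x y → R x ≡ true → orbit x y ≡ true → R y ≡ true
      orbit-closed x y rx h with orbit-elim x y h
      ... | inj₁ refl        = rx
      ... | inj₂ (inj₁ refl) = R-σ rx
      ... | inj₂ (inj₂ refl) = R-σ (R-σ rx)
      orbit-σ : ∀ x y → Orbit (σ x) y → Orbit x y
      orbit-σ x y (inj₁ e)        = inj₂ (inj₁ e)
      orbit-σ x y (inj₂ (inj₁ e)) = inj₂ (inj₂ e)
      orbit-σ x y (inj₂ (inj₂ e)) = inj₁ (trans e (σ³≡id x))
      orbit-σ⁻¹ : ∀ x y → Orbit x y → Orbit (σ x) y
      orbit-σ⁻¹ x y (inj₁ e)        = inj₂ (inj₂ (trans e (sym (σ³≡id x))))
      orbit-σ⁻¹ x y (inj₂ (inj₁ e)) = inj₁ e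
      orbit-σ⁻¹ x y (inj₂ (inj₂ e)) = inj₂ (inj₁ e)
      orbit-trans : ∀ x y z → orbit x y ≡ true → orbit y z ≡ orbit x z
      orbit-trans x y z h with orbit-elim x y h
      ... | inj₁ refl = refl
      ... | inj₂ (inj₁ refl) = bool-ext
        (λ h′ → orbit-intro x z (orbit-σ x z (orbit-elim (σ x) z h′)))
        (λ h′ → orbit-intro (σ x) z (orbit-σ⁻¹ x z (orbit-elim x z h′)))
      ... | inj₂ (inj₂ refl) = bool-ext
        (λ h′ → orbit-intro x z (orbit-σ x z (orbit-σ (σ x) z (orbit-elim (σ (σ x)) z h′))))
        (λ h′ → orbit-intro (σ (σ x)) z (orbit-σ⁻¹ (σ x) z (orbit-σ⁻¹ x z (orbit-elim x z h′))))

  surjective⇒injective : ∀ {n} (f : Fin n → Fin n) → (∀ y → ∃ λ x → f x ≡ y) → ∀ x y → f x ≡ f y → x ≡ y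
  surjective⇒injective {n} f surjective x y fx≡fy = trans (sym (section x)) (trans (cong g fx≡fy) (section y))
    where
    g : Fin n → Fin n
    g z = proj₁ (surjective z)
    g-injective : ∀ z z′ → g z ≡ g z′ → z ≡ z′
    g-injective z z′ eq = trans (sym (proj₂ (surjective z))) (trans (cong f eq) (proj₂ (surjective z′)))
    section : ∀ x → g (f x) ≡ x
    section x with image-elim g (count≥size⇒all (image g) (≤-reflexive (sym (count-image-injective g g-injective))) x)
    ... | z , gz≡x = trans (cong g (trans (sym (cong f gz≡x)) (proj₂ (surjective z)))) gz≡x

module FiniteGroup where

  open import Level using (0ℓ)
  open import Data.Nat.Base using (ℕ; zero; suc; _+_; _∸_; _≤_; _<_; _%_)
  open import Data.Nat.Properties
    using (+-cancelˡ-≡; +-identityʳ; +-mono-≤; ≤-trans; ≤-reflexive; _<?_; <-cmp; ≤-antisym; ≮⇒≥; m<n⇒0<n∸m; ≤-<-trans; m∸n≤m; m∸n+n≡m; <⇒≤)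
  open import Data.Nat.Divisibility using (_∣_)
  open import Data.Fin.Base using (Fin; zero; suc; toℕ; fromℕ<)
  open import Data.Fin.Properties using (toℕ-fromℕ<; toℕ<n; toℕ-injective)
  open import Relation.Nullary using (yes; no)
  open import Relation.Binary.Definitions using (tri<; tri≈; tri>)
  open import Data.Bool.Base using (Bool; true; false; not; _∧_; _∨_; _xor_)
  open import Data.Bool.Properties using (xor-same; xor-identityʳ; ¬-not)
  open import Data.Product using (∃; _×_; _,_; proj₁; proj₂)
  open import Data.Sum using (_⊎_; inj₁; inj₂)
  open import Data.Empty using (⊥; ⊥-elim)
  open import Relation.Binary.PropositionalEquality
  open import Algebra.Bundles using (Group; Monoid)
  open import Algebra.Structures using (IsGroup)
  import Algebra.Properties.Group as GroupProperties
  import Algebra.Solver.Monoid as MonoidSolver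
  open Counting
  open import Defs using (pow; HasOrder; HasOddOrder; ⟨_⟩; gen; unit; mul; inv; resp; GeneratedBy)

  record FinGroup (n : ℕ) : Set where
    infixl 7 _∙_
    infix 8 _⁻¹
    field
      _∙_     : Fin n → Fin n → Fin n
      ε       : Fin n
      _⁻¹     : Fin n → Fin n
      isGroup : IsGroup _≡_ _∙_ ε _⁻¹

    group : Group 0ℓ 0ℓ
    group = record { isGroup = isGroup }

    open IsGroup isGroup public using (assoc; identityˡ; identityʳ; inverseˡ; inverseʳ)
    open GroupProperties group public

    monoid : Monoid 0ℓ 0ℓ
    monoid = Group.monoid group

  module Properties {n : ℕ} (G : FinGroup n) where
    open FinGroup G public
    open MonoidSolver monoid public using (solve; _⊕_; _⊜_)
    open ≡-Reasoning

    ⁻¹∙[∙] : ∀ x y → x ⁻¹ ∙ (x ∙ y) ≡ y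
    ⁻¹∙[∙] x y = \\-leftDividesʳ x y

    ∙[⁻¹∙] : ∀ x y → x ∙ (x ⁻¹ ∙ y) ≡ y
    ∙[⁻¹∙] x y = \\-leftDividesˡ x y

    ∙≡∙⇒⁻¹∙≡∙⁻¹ : ∀ {a b c d} → a ∙ b ≡ c ∙ d → c ⁻¹ ∙ a ≡ d ∙ b ⁻¹
    ∙≡∙⇒⁻¹∙≡∙⁻¹ {a} {b} {c} {d} eq = begin
      c ⁻¹ ∙ a                ≡⟨ sym (//-rightDividesʳ b (c ⁻¹ ∙ a)) ⟩
      c ⁻¹ ∙ a ∙ b ∙ b ⁻¹     ≡⟨ cong (_∙ b ⁻¹) (assoc (c ⁻¹) a b) ⟩
      c ⁻¹ ∙ (a ∙ b) ∙ b ⁻¹   ≡⟨ cong (λ w → c ⁻¹ ∙ w ∙ b ⁻¹) eq ⟩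
      c ⁻¹ ∙ (c ∙ d) ∙ b ⁻¹   ≡⟨ cong (_∙ b ⁻¹) (⁻¹∙[∙] c d) ⟩
      d ∙ b ⁻¹                ∎

    conj : Fin n → Fin n → Fin n
    conj g t = g ∙ t ∙ g ⁻¹

    conj-∙ : ∀ g s t → conj g (s ∙ t) ≡ conj g s ∙ conj g t
    conj-∙ g s t = sym (begin
      g ∙ s ∙ g ⁻¹ ∙ (g ∙ t ∙ g ⁻¹)  ≡⟨ solve 5 (λ a b c d f → ((a ⊕ b) ⊕ c) ⊕ ((a ⊕ d) ⊕ f) ⊜ (a ⊕ b) ⊕ ((c ⊕ a) ⊕ (d ⊕ f))) refl g s (g ⁻¹) t (g ⁻¹) ⟩
      g ∙ s ∙ (g ⁻¹ ∙ g ∙ (t ∙ g ⁻¹)) ≡⟨ cong (λ w → g ∙ s ∙ (w ∙ (t ∙ g ⁻¹))) (inverseˡ g) ⟩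
      g ∙ s ∙ (ε ∙ (t ∙ g ⁻¹))        ≡⟨ cong (g ∙ s ∙_) (identityˡ _) ⟩
      g ∙ s ∙ (t ∙ g ⁻¹)              ≡⟨ solve 4 (λ a b c d → (a ⊕ b) ⊕ (c ⊕ d) ⊜ (a ⊕ (b ⊕ c)) ⊕ d) refl g s t (g ⁻¹) ⟩
      g ∙ (s ∙ t) ∙ g ⁻¹              ∎)

    conj-ε : ∀ g → conj g ε ≡ ε
    conj-ε g = trans (cong (_∙ g ⁻¹) (identityʳ g)) (inverseʳ g)

    conj-by-ε : ∀ t → conj ε t ≡ t
    conj-by-ε t = trans (cong (ε ∙ t ∙_) ε⁻¹≈ε) (trans (identityʳ _) (identityˡ t))

    conj-conj : ∀ g h t → conj g (conj h t) ≡ conj (g ∙ h) t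
    conj-conj g h t = begin
      g ∙ (h ∙ t ∙ h ⁻¹) ∙ g ⁻¹   ≡⟨ solve 5 (λ a b c d f → (a ⊕ ((b ⊕ c) ⊕ d)) ⊕ f ⊜ ((a ⊕ b) ⊕ c) ⊕ (d ⊕ f)) refl g h t (h ⁻¹) (g ⁻¹) ⟩
      g ∙ h ∙ t ∙ (h ⁻¹ ∙ g ⁻¹)   ≡⟨ cong (g ∙ h ∙ t ∙_) (sym (⁻¹-anti-homo-∙ g h)) ⟩
      g ∙ h ∙ t ∙ (g ∙ h) ⁻¹      ∎

    conj-⁻¹-conj : ∀ g t → conj (g ⁻¹) (conj g t) ≡ t
    conj-⁻¹-conj g t = trans (conj-conj (g ⁻¹) g t) (trans (cong (λ w → conj w t) (inverseˡ g)) (conj-by-ε t))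

    conj-conj-⁻¹ : ∀ g t → conj g (conj (g ⁻¹) t) ≡ t
    conj-conj-⁻¹ g t = trans (cong (λ h → conj h (conj (g ⁻¹) t)) (sym (⁻¹-involutive g))) (conj-⁻¹-conj (g ⁻¹) t)

    conj-injective : ∀ g {s t} → conj g s ≡ conj g t → s ≡ t
    conj-injective g {s} {t} eq = trans (sym (conj-⁻¹-conj g s)) (trans (cong (conj (g ⁻¹)) eq) (conj-⁻¹-conj g t))

    conj≡ε⇒≡ε : ∀ g {t} → conj g t ≡ ε → t ≡ ε
    conj≡ε⇒≡ε g eq = conj-injective g (trans eq (sym (conj-ε g)))

    conj≡⇒comm : ∀ g t → conj g t ≡ t → g ∙ t ≡ t ∙ g
    conj≡⇒comm g t eq = begin
      g ∙ t                ≡⟨ sym (//-rightDividesˡ g (g ∙ t)) ⟩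
      g ∙ t ∙ g ⁻¹ ∙ g     ≡⟨ cong (_∙ g) eq ⟩
      t ∙ g                ∎

    comm⇒conj≡ : ∀ g t → g ∙ t ≡ t ∙ g → conj g t ≡ t
    comm⇒conj≡ g t eq = trans (cong (_∙ g ⁻¹) eq) (//-rightDividesʳ g t)

    infix 9 _² _³
    _² : Fin n → Fin n
    x ² = x ∙ x

    _³ : Fin n → Fin n
    x ³ = x ∙ (x ∙ x)

    conj-² : ∀ g t → conj g (t ²) ≡ (conj g t) ²
    conj-² g t = conj-∙ g t t

    conj-³ : ∀ g t → conj g (t ³) ≡ (conj g t) ³
    conj-³ g t = trans (conj-∙ g t (t ∙ t)) (cong (conj g t ∙_) (conj-∙ g t t))

    ²-∙-comm : ∀ y u → y ∙ u ≡ u ∙ y → (y ∙ u) ² ≡ y ² ∙ u ²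
    ²-∙-comm y u yu≡uy = begin
      y ∙ u ∙ (y ∙ u)    ≡⟨ solve 4 (λ a b c d → (a ⊕ b) ⊕ (c ⊕ d) ⊜ (a ⊕ (b ⊕ c)) ⊕ d) refl y u y u ⟩
      y ∙ (u ∙ y) ∙ u    ≡⟨ cong (λ v → y ∙ v ∙ u) (sym yu≡uy) ⟩
      y ∙ (y ∙ u) ∙ u    ≡⟨ solve 3 (λ a b c → (a ⊕ (a ⊕ b)) ⊕ c ⊜ (a ⊕ a) ⊕ (b ⊕ c)) refl y u u ⟩
      y ∙ y ∙ (u ∙ u)    ∎

    ³-∙-comm : ∀ y u → y ∙ u ≡ u ∙ y → (y ∙ u) ³ ≡ y ³ ∙ u ³
    ³-∙-comm y u yu≡uy = begin
      y ∙ u ∙ (y ∙ u ∙ (y ∙ u))      ≡⟨ cong (y ∙ u ∙_) (²-∙-comm y u yu≡uy) ⟩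
      y ∙ u ∙ (y ∙ y ∙ (u ∙ u))      ≡⟨ solve 3 (λ a b c → (a ⊕ b) ⊕ ((a ⊕ a) ⊕ c) ⊜ (a ⊕ (b ⊕ (a ⊕ a))) ⊕ c) refl y u (u ∙ u) ⟩
      y ∙ (u ∙ (y ∙ y)) ∙ (u ∙ u)    ≡⟨ cong (λ v → y ∙ v ∙ (u ∙ u)) u∙y²≡y²∙u ⟩
      y ∙ (y ∙ y ∙ u) ∙ (u ∙ u)      ≡⟨ solve 2 (λ a b → (a ⊕ ((a ⊕ a) ⊕ b)) ⊕ (b ⊕ b) ⊜ (a ⊕ (a ⊕ a)) ⊕ (b ⊕ (b ⊕ b))) refl y u ⟩
      y ³ ∙ u ³                      ∎
      where
      u∙y²≡y²∙u : u ∙ (y ∙ y) ≡ y ∙ y ∙ u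
      u∙y²≡y²∙u = begin
        u ∙ (y ∙ y)  ≡⟨ sym (assoc u y y) ⟩
        u ∙ y ∙ y    ≡⟨ cong (_∙ y) (sym yu≡uy) ⟩
        y ∙ u ∙ y    ≡⟨ assoc y u y ⟩
        y ∙ (u ∙ y)  ≡⟨ cong (y ∙_) (sym yu≡uy) ⟩
        y ∙ (y ∙ u)  ≡⟨ sym (assoc y y u) ⟩
        y ∙ y ∙ u    ∎

    module Cube≡ε {p : Fin n} (p³≡ε : p ³ ≡ ε) where

      ⁻¹≡² : p ⁻¹ ≡ p ²
      ⁻¹≡² = sym (inverseʳ-unique p (p ²) p³≡ε)

      ²∙≡ε : p ² ∙ p ≡ ε
      ²∙≡ε = trans (assoc p p p) p³≡ε

      ²²≡ : (p ²) ² ≡ p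
      ²²≡ = begin
        p ∙ p ∙ (p ∙ p)   ≡⟨ solve 1 (λ a → (a ⊕ a) ⊕ (a ⊕ a) ⊜ (a ⊕ (a ⊕ a)) ⊕ a) refl p ⟩
        p ³ ∙ p           ≡⟨ cong (_∙ p) p³≡ε ⟩
        ε ∙ p             ≡⟨ identityˡ p ⟩
        p                 ∎

      ²³≡ε : (p ²) ³ ≡ ε
      ²³≡ε = trans (cong (p ² ∙_) ²²≡) ²∙≡ε

      ²≢ε : p ≢ ε → p ² ≢ ε
      ²≢ε p≢ε p²≡ε = p≢ε (trans (sym (trans (cong (p ∙_) p²≡ε) (identityʳ p))) p³≡ε)

      ²≢ : p ≢ ε → p ² ≢ p
      ²≢ p≢ε p²≡p = p≢ε (∙-cancelˡ p p ε (trans p²≡p (sym (identityʳ p))))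

    record IsSubgroup (H : Fin n → Bool) : Set where
      field
        ε∈  : H ε ≡ true
        ∙∈  : ∀ {x y} → H x ≡ true → H y ≡ true → H (x ∙ y) ≡ true
        ⁻¹∈ : ∀ {x} → H x ≡ true → H (x ⁻¹) ≡ true

    ∈-resp : ∀ (H : Fin n → Bool) {x y} → x ≡ y → H x ≡ true → H y ≡ true
    ∈-resp H refl h = h

    count-translate : ∀ (H : Fin n → Bool) x → count (λ y → H (x ∙ y)) ≡ count H
    count-translate H x = count-permute H (x ∙_) (x ⁻¹ ∙_) (∙[⁻¹∙] x) (⁻¹∙[∙] x)

    lagrange : ∀ {H} → IsSubgroup H → count H ∣ n
    lagrange {H} S = subst (count H ∣_) (count-true n)
      (uniform-partition⇒∣count coset (count H) n (λ _ → true) (count-≤-size (λ _ → true))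
         (λ x _ → ∈-resp H (sym (inverseˡ x)) ε∈)
         (λ _ _ _ _ → refl)
         (λ x y z _ x~y → bool-ext
            (λ y~z → ∈-resp H (cancel-middle x y z) (∙∈ x~y y~z))
            (λ x~z → ∈-resp H (trans (cong (_∙ (x ⁻¹ ∙ z)) (⁻¹-anti-homo-∙ (x ⁻¹) y))
                                     (trans (cong (λ w → y ⁻¹ ∙ w ∙ (x ⁻¹ ∙ z)) (⁻¹-involutive x)) (cancel-middle y x z)))
                               (∙∈ (⁻¹∈ x~y) x~z)))
         (λ x _ → count-translate H (x ⁻¹)))
      where
      open IsSubgroup S
      coset : Fin n → Fin n → Bool
      coset x y = H (x ⁻¹ ∙ y)
      cancel-middle : ∀ x y z → x ⁻¹ ∙ y ∙ (y ⁻¹ ∙ z) ≡ x ⁻¹ ∙ z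
      cancel-middle x y z = trans (assoc (x ⁻¹) y (y ⁻¹ ∙ z)) (cong (x ⁻¹ ∙_) (∙[⁻¹∙] y z))

    infixr 8 _^_
    _^_ : Fin n → ℕ → Fin n
    _^_ = pow group

    ^-+ : ∀ g i j → g ^ (i + j) ≡ g ^ i ∙ g ^ j
    ^-+ g zero    j = sym (identityˡ _)
    ^-+ g (suc i) j = trans (cong (g ∙_) (^-+ g i j)) (sym (assoc _ _ _))

    module _ {g : Fin n} {m : ℕ} (order : HasOrder group g m) where
      private
        m>0 = proj₁ order
        gᵐ≡ε = proj₁ (proj₂ order)
        minimal = proj₂ (proj₂ order)

      powers : Fin m → Fin n
      powers k = g ^ toℕ k

      powers-reach : ∀ i → ∃ λ (k : Fin m) → g ^ i ≡ powers k
      powers-reach zero = fromℕ< m>0 , cong (g ^_) (sym (toℕ-fromℕ< m>0))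
      powers-reach (suc i) with powers-reach i
      ... | k , eq with suc (toℕ k) <? m
      ...   | yes k+1<m = fromℕ< k+1<m , trans (cong (g ∙_) eq) (cong (g ^_) (sym (toℕ-fromℕ< k+1<m)))
      ...   | no  k+1≮m = fromℕ< m>0 , (begin
        g ∙ g ^ i           ≡⟨ cong (g ∙_) eq ⟩
        g ^ suc (toℕ k)     ≡⟨ cong (g ^_) (≤-antisym (toℕ<n k) (≮⇒≥ k+1≮m)) ⟩
        g ^ m               ≡⟨ gᵐ≡ε ⟩
        ε                   ≡⟨ cong (g ^_) (sym (toℕ-fromℕ< m>0)) ⟩
        powers (fromℕ< m>0) ∎)

      powers-distinct : ∀ a b → a < b → b < m → g ^ a ≢ g ^ b
      powers-distinct a b a<b b<m eq = minimal (b ∸ a) (m<n⇒0<n∸m a<b) (≤-<-trans (m∸n≤m b a) b<m)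
        (∙-cancelʳ (g ^ a) _ _ (begin
          g ^ (b ∸ a) ∙ g ^ a  ≡⟨ sym (^-+ g (b ∸ a) a) ⟩
          g ^ (b ∸ a + a)      ≡⟨ cong (g ^_) (m∸n+n≡m (<⇒≤ a<b)) ⟩
          g ^ b                ≡⟨ sym eq ⟩
          g ^ a                ≡⟨ sym (identityˡ _) ⟩
          ε ∙ g ^ a            ∎))

      powers-injective : ∀ i j → powers i ≡ powers j → i ≡ j
      powers-injective i j eq with <-cmp (toℕ i) (toℕ j)
      ... | tri≈ _ i≡j _ = toℕ-injective i≡j
      ... | tri< i<j _ _ = ⊥-elim (powers-distinct (toℕ i) (toℕ j) i<j (toℕ<n j) eq)
      ... | tri> _ _ j<i = ⊥-elim (powers-distinct (toℕ j) (toℕ i) j<i (toℕ<n i) (sym eq))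

      cyclic : Fin n → Bool
      cyclic = image powers

      cyclic-subgroup : IsSubgroup cyclic
      cyclic-subgroup = record
        { ε∈  = ∈cyclic 0
        ; ∙∈  = λ hx hy → let (i , eᵢ) = image-elim powers hx ; (j , eⱼ) = image-elim powers hy in
            ∈-resp cyclic (trans (^-+ g (toℕ i) (toℕ j)) (cong₂ _∙_ eᵢ eⱼ)) (∈cyclic (toℕ i + toℕ j))
        ; ⁻¹∈ = λ hx → let (k , eₖ) = image-elim powers hx in
            ∈-resp cyclic (trans (inverseˡ-unique _ _ (trans (sym (^-+ g (m ∸ toℕ k) (toℕ k)))
                                    (trans (cong (g ^_) (m∸n+n≡m (<⇒≤ (toℕ<n k)))) gᵐ≡ε)))
                                 (cong _⁻¹ eₖ))
              (∈cyclic (m ∸ toℕ k))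
        }
        where
        ∈cyclic : ∀ i → cyclic (g ^ i) ≡ true
        ∈cyclic i = let (k , eq) = powers-reach i in image-intro powers k (sym eq)

      order∣size : m ∣ n
      order∣size = subst (_∣ n) (count-image-injective powers powers-injective) (lagrange cyclic-subgroup)

    opaque
      ⟨_⟩₃ : Fin n → Fin n → Bool
      ⟨ p ⟩₃ y = (y == ε) ∨ ((y == p) ∨ (y == p ²))

      ⟨⟩₃-elim : ∀ {p y} → ⟨ p ⟩₃ y ≡ true → y ≡ ε ⊎ y ≡ p ⊎ y ≡ p ²
      ⟨⟩₃-elim {p} {y} h with ∨-elim {y == ε} h
      ... | inj₁ h₀ = inj₁ (==⇒≡ h₀)
      ... | inj₂ h₁ with ∨-elim {y == p} h₁
      ...   | inj₁ h₂ = inj₂ (inj₁ (==⇒≡ h₂))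
      ...   | inj₂ h₂ = inj₂ (inj₂ (==⇒≡ h₂))

      ε∈⟨⟩₃ : ∀ p → ⟨ p ⟩₃ ε ≡ true
      ε∈⟨⟩₃ p = ∨-introˡ _ (==-refl ε)

      p∈⟨p⟩₃ : ∀ p → ⟨ p ⟩₃ p ≡ true
      p∈⟨p⟩₃ p = ∨-introʳ (p == ε) (∨-introˡ _ (==-refl p))

      p²∈⟨p⟩₃ : ∀ p → ⟨ p ⟩₃ (p ²) ≡ true
      p²∈⟨p⟩₃ p = ∨-introʳ (p ² == ε) (∨-introʳ (p ² == p) (==-refl (p ²)))

      count-⟨⟩₃≤3 : ∀ p → count ⟨ p ⟩₃ ≤ 3
      count-⟨⟩₃≤3 p = ≤-trans (count-∨-≤ (λ y → y == ε) (λ y → (y == p) ∨ (y == p ²)))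
        (+-mono-≤ (≤-reflexive (count-== ε))
                  (≤-trans (count-∨-≤ (λ y → y == p) (λ y → y == p ²))
                           (+-mono-≤ (≤-reflexive (count-== p)) (≤-reflexive (count-== (p ²))))))

    power₃ : Fin n → Fin 3 → Fin n
    power₃ p zero             = ε
    power₃ p (suc zero)       = p
    power₃ p (suc (suc zero)) = p ²

    power₃∈⟨⟩₃ : ∀ p i → ⟨ p ⟩₃ (power₃ p i) ≡ true
    power₃∈⟨⟩₃ p zero             = ε∈⟨⟩₃ p
    power₃∈⟨⟩₃ p (suc zero)       = p∈⟨p⟩₃ p
    power₃∈⟨⟩₃ p (suc (suc zero)) = p²∈⟨p⟩₃ p

    ∈⟨⟩₃⇒power₃ : ∀ p {y} → ⟨ p ⟩₃ y ≡ true → ∃ λ i → power₃ p i ≡ y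
    ∈⟨⟩₃⇒power₃ p {y} h with ⟨⟩₃-elim {p} {y} h
    ... | inj₁ refl        = zero , refl
    ... | inj₂ (inj₁ refl) = suc zero , refl
    ... | inj₂ (inj₂ refl) = suc (suc zero) , refl

    ⟨⟩₃-comm : ∀ {p x y} → ⟨ p ⟩₃ x ≡ true → ⟨ p ⟩₃ y ≡ true → x ∙ y ≡ y ∙ x
    ⟨⟩₃-comm {p} {x} {y} x∈ y∈ with ⟨⟩₃-elim {p} {x} x∈ | ⟨⟩₃-elim {p} {y} y∈
    ... | inj₁ refl        | _                = trans (identityˡ y) (sym (identityʳ y))
    ... | _                | inj₁ refl        = trans (identityʳ x) (sym (identityˡ x))
    ... | inj₂ (inj₁ refl) | inj₂ (inj₁ refl) = refl
    ... | inj₂ (inj₁ refl) | inj₂ (inj₂ refl) = sym (assoc p p p)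
    ... | inj₂ (inj₂ refl) | inj₂ (inj₁ refl) = assoc p p p
    ... | inj₂ (inj₂ refl) | inj₂ (inj₂ refl) = refl

    conj-∈⟨⟩₃ : ∀ g {t y} → ⟨ t ⟩₃ y ≡ true → ⟨ conj g t ⟩₃ (conj g y) ≡ true
    conj-∈⟨⟩₃ g {t} {y} y∈ with ⟨⟩₃-elim {t} {y} y∈
    ... | inj₁ refl        = ∈-resp ⟨ conj g t ⟩₃ (sym (conj-ε g)) (ε∈⟨⟩₃ (conj g t))
    ... | inj₂ (inj₁ refl) = p∈⟨p⟩₃ (conj g t)
    ... | inj₂ (inj₂ refl) = ∈-resp ⟨ conj g t ⟩₃ (sym (conj-² g t)) (p²∈⟨p⟩₃ (conj g t))

    opaque
      order3 : Fin n → Bool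
      order3 x = (x ³ == ε) ∧ not (x == ε)

      order3-intro : ∀ {x} → x ³ ≡ ε → x ≢ ε → order3 x ≡ true
      order3-intro x³≡ε x≢ε = ∧-intro (≡⇒== x³≡ε) (not-intro (≢⇒==false x≢ε))

      order3⇒³≡ε : ∀ {x} → order3 x ≡ true → x ³ ≡ ε
      order3⇒³≡ε {x} h = ==⇒≡ (proj₁ (∧-elim {x ³ == ε} h))

      order3⇒≢ε : ∀ {x} → order3 x ≡ true → x ≢ ε
      order3⇒≢ε {x} h x≡ε = true≢false (trans (sym (≡⇒== x≡ε)) (not-elim (proj₂ (∧-elim {x ³ == ε} h))))

    order3-conj : ∀ g {t} → order3 t ≡ true → order3 (conj g t) ≡ true
    order3-conj g h = order3-intro (trans (sym (conj-³ g _)) (trans (cong (conj g) (order3⇒³≡ε h)) (conj-ε g)))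
                                   (λ eq → order3⇒≢ε h (conj≡ε⇒≡ε g eq))

    module Order3 {p : Fin n} (order3-p : order3 p ≡ true) where
      open Cube≡ε (order3⇒³≡ε order3-p) public

      p≢ε : p ≢ ε
      p≢ε = order3⇒≢ε order3-p

      order3-² : order3 (p ²) ≡ true
      order3-² = order3-intro ²³≡ε (²≢ε p≢ε)

      ⟨⟩₃-∙ : ∀ {x y} → ⟨ p ⟩₃ x ≡ true → ⟨ p ⟩₃ y ≡ true → ⟨ p ⟩₃ (x ∙ y) ≡ true
      ⟨⟩₃-∙ {x} {y} hx hy with ⟨⟩₃-elim {p} {x} hx | ⟨⟩₃-elim {p} {y} hy
      ... | inj₁ refl        | _                = ∈-resp ⟨ p ⟩₃ (sym (identityˡ y)) hy
      ... | _                | inj₁ refl        = ∈-resp ⟨ p ⟩₃ (sym (identityʳ x)) hx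
      ... | inj₂ (inj₁ refl) | inj₂ (inj₁ refl) = p²∈⟨p⟩₃ p
      ... | inj₂ (inj₁ refl) | inj₂ (inj₂ refl) = ∈-resp ⟨ p ⟩₃ (sym (order3⇒³≡ε order3-p)) (ε∈⟨⟩₃ p)
      ... | inj₂ (inj₂ refl) | inj₂ (inj₁ refl) = ∈-resp ⟨ p ⟩₃ (sym ²∙≡ε) (ε∈⟨⟩₃ p)
      ... | inj₂ (inj₂ refl) | inj₂ (inj₂ refl) = ∈-resp ⟨ p ⟩₃ (sym ²²≡) (p∈⟨p⟩₃ p)

      ⟨⟩₃-⁻¹ : ∀ {x} → ⟨ p ⟩₃ x ≡ true → ⟨ p ⟩₃ (x ⁻¹) ≡ true
      ⟨⟩₃-⁻¹ {x} hx with ⟨⟩₃-elim {p} {x} hx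
      ... | inj₁ refl        = ∈-resp ⟨ p ⟩₃ (sym ε⁻¹≈ε) (ε∈⟨⟩₃ p)
      ... | inj₂ (inj₁ refl) = ∈-resp ⟨ p ⟩₃ (sym ⁻¹≡²) (p²∈⟨p⟩₃ p)
      ... | inj₂ (inj₂ refl) = ∈-resp ⟨ p ⟩₃ (inverseʳ-unique (p ²) p ²∙≡ε) (p∈⟨p⟩₃ p)

      ⟨⟩₃-conj : ∀ {v y} → ⟨ p ⟩₃ v ≡ true → ⟨ p ⟩₃ y ≡ true → ⟨ p ⟩₃ (conj v y) ≡ true
      ⟨⟩₃-conj v∈ y∈ = ⟨⟩₃-∙ (⟨⟩₃-∙ v∈ y∈) (⟨⟩₃-⁻¹ v∈)

      ⟨⟩₃-⊆ : ∀ {q y} → ⟨ p ⟩₃ q ≡ true → ⟨ q ⟩₃ y ≡ true → ⟨ p ⟩₃ y ≡ true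
      ⟨⟩₃-⊆ {q} {y} q∈ y∈ with ⟨⟩₃-elim {q} {y} y∈
      ... | inj₁ refl        = ε∈⟨⟩₃ p
      ... | inj₂ (inj₁ refl) = q∈
      ... | inj₂ (inj₂ refl) = ⟨⟩₃-∙ q∈ q∈

      power₃-injective : ∀ i j → power₃ p i ≡ power₃ p j → i ≡ j
      power₃-injective zero             zero             _  = refl
      power₃-injective zero             (suc zero)       eq = ⊥-elim (p≢ε (sym eq))
      power₃-injective zero             (suc (suc zero)) eq = ⊥-elim (²≢ε p≢ε (sym eq))
      power₃-injective (suc zero)       zero             eq = ⊥-elim (p≢ε eq)
      power₃-injective (suc zero)       (suc zero)       _  = refl
      power₃-injective (suc zero)       (suc (suc zero)) eq = ⊥-elim (²≢ p≢ε (sym eq))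
      power₃-injective (suc (suc zero)) zero             eq = ⊥-elim (²≢ε p≢ε eq)
      power₃-injective (suc (suc zero)) (suc zero)       eq = ⊥-elim (²≢ p≢ε eq)
      power₃-injective (suc (suc zero)) (suc (suc zero)) _  = refl

      ⟨⟩₃-generator : ∀ {y} → ⟨ p ⟩₃ y ≡ true → y ≢ ε → ⟨ y ⟩₃ p ≡ true
      ⟨⟩₃-generator {y} h y≢ε with ⟨⟩₃-elim {p} {y} h
      ... | inj₁ refl        = ⊥-elim (y≢ε refl)
      ... | inj₂ (inj₁ refl) = p∈⟨p⟩₃ p
      ... | inj₂ (inj₂ refl) = ∈-resp ⟨ p ² ⟩₃ ²²≡ (p²∈⟨p⟩₃ (p ²))

    module Generated (generated : GeneratedBy group (HasOddOrder group)) where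

      generated-induction : (P : Fin n → Set) → P ε → (∀ {x y} → P x → P y → P (x ∙ y)) →
        (∀ {x} → P x → P (x ⁻¹)) → (∀ {g} → HasOddOrder group g → P g) → ∀ g → P g
      generated-induction P ε∈ ∙∈ ⁻¹∈ odd∈ g = go (generated g)
        where
        go : ∀ {g} → ⟨_⟩ group (HasOddOrder group) g → P g
        go (gen odd)   = odd∈ odd
        go unit        = ε∈
        go (mul p q)   = ∙∈ (go p) (go q)
        go (inv p)     = ⁻¹∈ (go p)
        go (resp eq p) = subst P eq (go p)

      module _ (χ : Fin n → Bool) (χ-hom : ∀ x y → χ (x ∙ y) ≡ χ x xor χ y) where

        χ-ε : χ ε ≡ false
        χ-ε = trans (cong χ (sym (identityˡ ε))) (trans (χ-hom ε ε) (xor-same (χ ε)))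

        χ-^-odd : ∀ g m → m % 2 ≡ 1 → χ (g ^ m) ≡ χ g
        χ-^-odd g 1             _   = cong χ (identityʳ g)
        χ-^-odd g (suc (suc m)) odd = begin
          χ (g ∙ (g ∙ g ^ m))         ≡⟨ trans (χ-hom g _) (cong (χ g xor_) (χ-hom g _)) ⟩
          χ g xor (χ g xor χ (g ^ m)) ≡⟨ cong (λ b → χ g xor (χ g xor b)) (χ-^-odd g m odd) ⟩
          χ g xor (χ g xor χ g)       ≡⟨ cong (χ g xor_) (xor-same (χ g)) ⟩
          χ g xor false               ≡⟨ xor-identityʳ (χ g) ⟩
          χ g                         ∎

        xor-hom-trivial : ∀ g → χ g ≡ false
        xor-hom-trivial = generated-induction (λ g → χ g ≡ false) χ-ε
          (λ χx χy → trans (χ-hom _ _) (cong₂ _xor_ χx χy))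
          (λ {x} χx → begin
            χ (x ⁻¹)             ≡⟨ sym (xor-identityʳ _) ⟩
            χ (x ⁻¹) xor false   ≡⟨ cong (χ (x ⁻¹) xor_) (sym χx) ⟩
            χ (x ⁻¹) xor χ x     ≡⟨ sym (χ-hom (x ⁻¹) x) ⟩
            χ (x ⁻¹ ∙ x)         ≡⟨ cong χ (inverseˡ x) ⟩
            χ ε                  ≡⟨ χ-ε ⟩
            false                ∎)
          (λ {g} (m , (_ , gᵐ≡ε , _) , odd) → trans (sym (χ-^-odd g m odd)) (trans (cong χ gᵐ≡ε) χ-ε))

      no-index-2 : ∀ {H} → IsSubgroup H → count H + count H ≢ n
      no-index-2 {H} S index-2 = 1≰0 (subst (1 ≤_) H-empty (count-pos H ε ε∈))
        where
        open IsSubgroup S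
        1≰0 : 1 ≤ 0 → ⊥
        1≰0 ()
        ∈-cancelˡ : ∀ {x y} → H x ≡ true → H (x ∙ y) ≡ true → H y ≡ true
        ∈-cancelˡ {x} {y} hx hxy = ∈-resp H (⁻¹∙[∙] x y) (∙∈ (⁻¹∈ hx) hxy)
        ∈-cancelʳ : ∀ {x y} → H y ≡ true → H (x ∙ y) ≡ true → H x ≡ true
        ∈-cancelʳ {x} {y} hy hxy = ∈-resp H (//-rightDividesʳ y x) (∙∈ hxy (⁻¹∈ hy))
        ∉∙∉ : ∀ {x y} → H x ≡ false → H y ≡ false → H (x ∙ y) ≡ true
        ∉∙∉ {x} {y} hx hy = ⊆∧count-≥⇒⊇ (λ w → H (x ∙ w)) (λ w → not (H w))
          (λ w hxw → not-intro (¬-not λ hw → true≢false (trans (sym (∈-cancelʳ hw hxw)) hx)))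
          (≤-reflexive (trans (+-cancelˡ-≡ (count H) _ _ (trans (count-not H) (sym index-2)))
                              (sym (count-translate H x))))
          y (not-intro hy)
        χ-hom : ∀ x y → not (H (x ∙ y)) ≡ not (H x) xor not (H y)
        χ-hom x y with H x in hx | H y in hy
        ... | true  | true  rewrite ∙∈ hx hy = refl
        ... | true  | false rewrite ¬-not {H (x ∙ y)} (λ hxy → true≢false (trans (sym (∈-cancelˡ hx hxy)) hy)) = refl
        ... | false | true  rewrite ¬-not {H (x ∙ y)} (λ hxy → true≢false (trans (sym (∈-cancelʳ hy hxy)) hx)) = refl
        ... | false | false rewrite ∉∙∉ hx hy = refl
        H-all : ∀ y → H y ≡ true
        H-all y with H y in hy | xor-hom-trivial (λ w → not (H w)) χ-hom y
        ... | true | _ = refl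
        H-empty : count H ≡ 0
        H-empty = +-cancelˡ-≡ (count H) _ _ (trans index-2 (sym (trans (+-identityʳ _) (trans (count-cong H-all) (count-true n)))))

module Presentation where

  open import Data.Nat.Base using (ℕ)
  open import Data.Fin.Base using (Fin)
  open import Data.Vec.Base using (Vec; lookup; _∷_; [])
  open import Data.Bool.Base using (Bool; true; not; _∧_; _∨_)
  open import Data.Product using (∃; _×_; _,_; proj₁; proj₂)
  open import Data.Sum using (inj₁; inj₂)
  open import Data.Empty using (⊥-elim)
  open import Data.List.Base using (List; []; _∷_; _++_; [_]; take; drop; length)
  open import Data.List.Properties using (take++drop≡id) renaming (≡-dec to ≡-decᴸ)
  open import Data.Maybe.Base using (Maybe; just; nothing)
  open import Data.Maybe.Properties using () renaming (≡-dec to ≡-decᴹ)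
  open import Relation.Nullary using (Dec; yes; no; does)
  open import Relation.Nullary.Decidable using (map′; _×-dec_; dec-true)
  open import Relation.Binary.Definitions using (DecidableEquality)
  open import Relation.Binary.PropositionalEquality hiding ([_])
  open import Tactic.RingSolver using (solve-∀)
  open import Defs using (F3; o; i; t; _+₃_; _*₃_; -₃_; F3-ring; M2; mat; _·_; det; adj; I2; det-mult; det-adj'; SL₂F₃)
  open FiniteGroup using (FinGroup; module Properties)
  open Counting using (true≢false; ∧-elim; ∨-elim; any; any-elim; all-elim; image; image-intro; image-elim; surjective⇒injective)

  _≟₃_ : DecidableEquality F3
  o ≟₃ o = yes refl
  o ≟₃ i = no λ ()
  o ≟₃ t = no λ ()
  i ≟₃ o = no λ ()
  i ≟₃ i = yes refl
  i ≟₃ t = no λ ()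
  t ≟₃ o = no λ ()
  t ≟₃ i = no λ ()
  t ≟₃ t = yes refl

  infix 4 _≟₃_ _≟ᴹ_

  _≟ᴹ_ : DecidableEquality M2
  mat a b c d ≟ᴹ mat a′ b′ c′ d′ =
    map′ (λ { (refl , refl , refl , refl) → refl }) (λ { refl → refl , refl , refl , refl })
         (a ≟₃ a′ ×-dec b ≟₃ b′ ×-dec c ≟₃ c′ ×-dec d ≟₃ d′)

  decided : ∀ {A : Set} (A? : Dec A) → does A? ≡ true → A
  decided (yes a) _ = a

  every-F3 : (F3 → Bool) → Bool
  every-F3 P = P o ∧ P i ∧ P t

  every-F3-sound : ∀ P → every-F3 P ≡ true → ∀ x → P x ≡ true
  every-F3-sound P h o with ∧-elim {P o} h
  ... | Po , _ = Po
  every-F3-sound P h i with ∧-elim {P o} h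
  ... | _ , h′ = proj₁ (∧-elim {P i} h′)
  every-F3-sound P h t with ∧-elim {P o} h
  ... | _ , h′ = proj₂ (∧-elim {P i} h′)

  every-M2 : (M2 → Bool) → Bool
  every-M2 P = every-F3 λ a → every-F3 λ b → every-F3 λ c → every-F3 λ d → P (mat a b c d)

  every-M2-sound : ∀ P → every-M2 P ≡ true → ∀ m → P m ≡ true
  every-M2-sound P h (mat a b c d) =
    every-F3-sound (λ d → P (mat a b c d))
      (every-F3-sound (λ c → every-F3 λ d → P (mat a b c d))
        (every-F3-sound (λ b → every-F3 λ c → every-F3 λ d → P (mat a b c d))
          (every-F3-sound (λ a → every-F3 λ b → every-F3 λ c → every-F3 λ d → P (mat a b c d)) h a) b) c) d

  every-SL₂ : (M2 → Bool) → Bool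
  every-SL₂ P = every-M2 λ m → not (does (det m ≟₃ i)) ∨ P m

  every-SL₂-sound : ∀ P → every-SL₂ P ≡ true → ∀ m → det m ≡ i → P m ≡ true
  every-SL₂-sound P h m det≡1 with ∨-elim {not (does (det m ≟₃ i))} (every-M2-sound (λ m → not (does (det m ≟₃ i)) ∨ P m) h m)
  ... | inj₁ ¬det≡1 = ⊥-elim (true≢false (sym (trans (sym (cong not (dec-true (det m ≟₃ i) det≡1))) ¬det≡1)))
  ... | inj₂ Pm     = Pm

  ·-assoc : ∀ m n p → (m · n) · p ≡ m · (n · p)
  ·-assoc (mat a b c d) (mat e f g h) (mat p q r s) =
    cong₂ (λ u v → mat (proj₁ u) (proj₂ u) (proj₁ v) (proj₂ v))
      (cong₂ _,_ (entry a b e f g h p r) (entry a b e f g h q s))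
      (cong₂ _,_ (entry c d e f g h p r) (entry c d e f g h q s))
    where
    entry : ∀ (a b e f g h p r : F3) →
      (a *₃ e +₃ b *₃ g) *₃ p +₃ (a *₃ f +₃ b *₃ h) *₃ r ≡ a *₃ (e *₃ p +₃ f *₃ r) +₃ b *₃ (g *₃ p +₃ h *₃ r)
    entry = solve-∀ F3-ring

  ·-identityʳ : ∀ m → m · I2 ≡ m
  ·-identityʳ (mat a b c d) = cong₂ (λ u v → mat (proj₁ u) (proj₂ u) (proj₁ v) (proj₂ v))
    (cong₂ _,_ (first a b) (second a b)) (cong₂ _,_ (first c d) (second c d))
    where
    first : ∀ x y → x *₃ i +₃ y *₃ o ≡ x
    first = solve-∀ F3-ring
    second : ∀ x y → x *₃ o +₃ y *₃ i ≡ y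
    second = solve-∀ F3-ring

  adj-inverseˡ : ∀ m → det m ≡ i → adj m · m ≡ I2
  adj-inverseˡ m det≡1 = decided (adj m · m ≟ᴹ I2) (every-SL₂-sound (λ m → does (adj m · m ≟ᴹ I2)) refl m det≡1)

  data Letter : Set where
    α ξ : Letter

  _≟ᴸ_ : DecidableEquality Letter
  α ≟ᴸ α = yes refl
  α ≟ᴸ ξ = no λ ()
  ξ ≟ᴸ α = no λ ()
  ξ ≟ᴸ ξ = yes refl

  Word : Set
  Word = List Letter

  _≟ᵂ_ : DecidableEquality Word
  _≟ᵂ_ = ≡-decᴸ _≟ᴸ_

  letter-matrix : Letter → M2
  letter-matrix α = mat o i t t
  letter-matrix ξ = mat o t i o

  det-letter-matrix : ∀ s → det (letter-matrix s) ≡ i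
  det-letter-matrix α = refl
  det-letter-matrix ξ = refl

  evalᴹ : Word → M2
  evalᴹ []      = I2
  evalᴹ (s ∷ w) = letter-matrix s · evalᴹ w

  data Relator : Set where
    α³ [αξ]³ ξ⁴ ξ²α : Relator

  relation : Relator → Word × Word
  relation α³    = α ∷ α ∷ α ∷ [] , []
  relation [αξ]³ = α ∷ ξ ∷ α ∷ ξ ∷ α ∷ ξ ∷ [] , []
  relation ξ⁴    = ξ ∷ ξ ∷ ξ ∷ ξ ∷ [] , []
  relation ξ²α   = ξ ∷ ξ ∷ α ∷ [] , α ∷ ξ ∷ ξ ∷ []

  data Direction : Set where
    forward backward : Direction

  oriented : Direction → Relator → Word × Word
  oriented forward  r = relation r
  oriented backward r = proj₂ (relation r) , proj₁ (relation r)

  data Step : Set where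
    step : (position : ℕ) (relator : Relator) (direction : Direction) → Step

  apply : Step → Word → Maybe Word
  apply (step k r d) w with proj₁ (oriented d r) ≟ᵂ take (length (proj₁ (oriented d r))) (drop k w)
  ... | yes _ = just (take k w ++ proj₂ (oriented d r) ++ drop (length (proj₁ (oriented d r))) (drop k w))
  ... | no  _ = nothing

  apply-all : List Step → Word → Maybe Word
  apply-all []       w = just w
  apply-all (s ∷ ss) w with apply s w
  ... | just w′ = apply-all ss w′
  ... | nothing = nothing

  rewrites-to : List Step → Word → Word → Bool
  rewrites-to ss w w′ = does (≡-decᴹ _≟ᵂ_ (apply-all ss w) (just w′))

  -- Normal forms and rewriting certificates

  normal-form : M2 → Word
  normal-form (mat o i t o) = ξ ∷ ξ ∷ ξ ∷ []
  normal-form (mat o i t i) = α ∷ ξ ∷ α ∷ []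
  normal-form (mat o i t t) = α ∷ []
  normal-form (mat o t i o) = ξ ∷ []
  normal-form (mat o t i i) = α ∷ ξ ∷ ξ ∷ []
  normal-form (mat o t i t) = α ∷ ξ ∷ α ∷ ξ ∷ ξ ∷ []
  normal-form (mat i o i i) = α ∷ ξ ∷ α ∷ ξ ∷ []
  normal-form (mat i o t i) = α ∷ ξ ∷ []
  normal-form (mat i i o i) = ξ ∷ α ∷ []
  normal-form (mat i i i t) = α ∷ α ∷ ξ ∷ α ∷ ξ ∷ []
  normal-form (mat i i t o) = α ∷ α ∷ ξ ∷ ξ ∷ []
  normal-form (mat i t o i) = ξ ∷ α ∷ ξ ∷ α ∷ []
  normal-form (mat i t i o) = ξ ∷ α ∷ ξ ∷ []
  normal-form (mat i t t t) = ξ ∷ α ∷ ξ ∷ α ∷ α ∷ []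
  normal-form (mat t o o t) = ξ ∷ ξ ∷ []
  normal-form (mat t o i t) = α ∷ ξ ∷ ξ ∷ ξ ∷ []
  normal-form (mat t o t t) = ξ ∷ α ∷ α ∷ []
  normal-form (mat t i o t) = α ∷ α ∷ ξ ∷ []
  normal-form (mat t i i i) = α ∷ α ∷ ξ ∷ α ∷ []
  normal-form (mat t i t o) = α ∷ α ∷ ξ ∷ α ∷ α ∷ []
  normal-form (mat t t o t) = ξ ∷ α ∷ ξ ∷ ξ ∷ []
  normal-form (mat t t i o) = α ∷ α ∷ []
  normal-form (mat t t t i) = α ∷ ξ ∷ α ∷ α ∷ []
  normal-form _ = []

  certificate : M2 → Letter → List Step
  certificate (mat o i t o) α = step 1 ξ²α forward ∷ []
  certificate (mat o i t o) ξ = step 0 ξ⁴ forward ∷ []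
  certificate (mat o t i i) α = step 1 ξ²α forward ∷ []
  certificate (mat o t i t) α = step 3 ξ²α forward ∷ step 3 ξ²α backward ∷ step 2 ξ²α backward ∷ step 6 [αξ]³ backward ∷ step 4 α³ forward ∷ step 1 ξ⁴ forward ∷ []
  certificate (mat o t i t) ξ = step 2 ξ²α backward ∷ step 0 ξ²α backward ∷ step 1 α³ backward ∷ step 3 [αξ]³ forward ∷ []
  certificate (mat i o i i) α = step 5 ξ⁴ backward ∷ step 0 [αξ]³ forward ∷ []
  certificate (mat i i i t) α = step 6 ξ⁴ backward ∷ step 1 [αξ]³ forward ∷ []
  certificate (mat i i i t) ξ = step 3 ξ²α backward ∷ step 2 [αξ]³ backward ∷ step 7 ξ⁴ forward ∷ step 0 α³ forward ∷ []
  certificate (mat i i t o) α = step 2 ξ²α forward ∷ step 0 α³ forward ∷ []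
  certificate (mat i i t o) ξ = step 2 [αξ]³ backward ∷ step 7 ξ⁴ forward ∷ step 0 α³ forward ∷ []
  certificate (mat i t o i) ξ = step 0 α³ backward ∷ step 2 [αξ]³ forward ∷ []
  certificate (mat i t t t) α = step 3 α³ forward ∷ []
  certificate (mat i t t t) ξ = step 6 ξ⁴ backward ∷ step 4 ξ²α backward ∷ step 3 ξ²α backward ∷ step 7 [αξ]³ backward ∷ step 5 α³ forward ∷ step 2 ξ⁴ forward ∷ step 5 ξ⁴ forward ∷ step 3 [αξ]³ backward ∷ step 1 α³ forward ∷ step 5 ξ²α forward ∷ step 5 ξ²α backward ∷ step 4 ξ²α backward ∷ step 8 [αξ]³ backward ∷ step 6 α³ forward ∷ step 3 ξ⁴ forward ∷ step 0 ξ²α forward ∷ step 1 ξ²α forward ∷ step 3 ξ²α forward ∷ step 3 ξ²α backward ∷ step 1 ξ²α backward ∷ step 2 α³ backward ∷ step 4 [αξ]³ forward ∷ []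
  certificate (mat t o o t) α = step 0 ξ²α forward ∷ []
  certificate (mat t o i t) α = step 2 ξ²α forward ∷ []
  certificate (mat t o i t) ξ = step 1 ξ⁴ forward ∷ []
  certificate (mat t o t t) α = step 1 α³ forward ∷ []
  certificate (mat t o t t) ξ = step 4 ξ⁴ backward ∷ step 2 ξ²α backward ∷ step 1 ξ²α backward ∷ step 5 [αξ]³ backward ∷ step 3 α³ forward ∷ step 0 ξ⁴ forward ∷ step 3 ξ⁴ forward ∷ []
  certificate (mat t i t o) α = step 3 α³ forward ∷ []
  certificate (mat t i t o) ξ = step 6 ξ⁴ backward ∷ step 4 ξ²α backward ∷ step 3 ξ²α backward ∷ step 7 [αξ]³ backward ∷ step 5 α³ forward ∷ step 2 ξ⁴ forward ∷ step 5 ξ⁴ forward ∷ step 0 α³ forward ∷ []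
  certificate (mat t t o t) α = step 2 ξ²α forward ∷ step 2 ξ²α backward ∷ step 1 ξ²α backward ∷ step 5 [αξ]³ backward ∷ step 3 α³ forward ∷ step 0 ξ⁴ forward ∷ []
  certificate (mat t t o t) ξ = step 0 α³ backward ∷ step 4 ξ²α backward ∷ step 2 ξ²α backward ∷ step 3 α³ backward ∷ step 5 [αξ]³ forward ∷ []
  certificate (mat t t i o) α = step 0 α³ forward ∷ []
  certificate (mat t t t i) α = step 2 α³ forward ∷ []
  certificate (mat t t t i) ξ = step 5 ξ⁴ backward ∷ step 3 ξ²α backward ∷ step 2 ξ²α backward ∷ step 6 [αξ]³ backward ∷ step 4 α³ forward ∷ step 1 ξ⁴ forward ∷ step 4 ξ⁴ forward ∷ []
  certificate _ _ = []

  normal-form-correct : ∀ m → det m ≡ i → evalᴹ (normal-form m) ≡ m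
  normal-form-correct m det≡1 =
    decided (evalᴹ (normal-form m) ≟ᴹ m) (every-SL₂-sound (λ m → does (evalᴹ (normal-form m) ≟ᴹ m)) refl m det≡1)

  certificate-valid : ∀ m → det m ≡ i → ∀ s →
    rewrites-to (certificate m s) (normal-form m ++ [ s ]) (normal-form (m · letter-matrix s)) ≡ true
  certificate-valid m det≡1 s = every-SL₂-sound (valid s) (all-valid s) m det≡1
    where
    valid : Letter → M2 → Bool
    valid s m = rewrites-to (certificate m s) (normal-form m ++ [ s ]) (normal-form (m · letter-matrix s))
    all-valid : ∀ s → every-SL₂ (valid s) ≡ true
    all-valid α = refl
    all-valid ξ = refl

  sl₂-elements : Vec M2 24
  sl₂-elements =
    mat o i t o ∷ mat o i t i ∷ mat o i t t ∷ mat o t i o ∷ mat o t i i ∷ mat o t i t ∷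
    mat i o o i ∷ mat i o i i ∷ mat i o t i ∷ mat i i o i ∷ mat i i i t ∷ mat i i t o ∷
    mat i t o i ∷ mat i t i o ∷ mat i t t t ∷ mat t o o t ∷ mat t o i t ∷ mat t o t t ∷
    mat t i o t ∷ mat t i i i ∷ mat t i t o ∷ mat t t o t ∷ mat t t i o ∷ mat t t t i ∷ []

  element : Fin 24 → M2
  element k = lookup sl₂-elements k

  det-element : ∀ k → det (element k) ≡ i
  det-element k = decided (det (element k) ≟₃ i) (all-elim (λ k → does (det (element k) ≟₃ i)) refl k)

  element-surjective : ∀ m → det m ≡ i → ∃ λ k → element k ≡ m
  element-surjective m det≡1 with any-elim (λ k → does (element k ≟ᴹ m))
                                     (every-SL₂-sound (λ m → any (λ k → does (element k ≟ᴹ m))) refl m det≡1)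
  ... | k , h = k , decided (element k ≟ᴹ m) h

  module _ {n : ℕ} (G : FinGroup n) where
    open Properties G

    record SL₂Generators : Set where
      field
        generator : Letter → Fin n
        α³≡ε      : generator α ³ ≡ ε
        [αξ]³≡ε   : (generator α ∙ generator ξ) ³ ≡ ε
        ξ⁴≡ε      : (generator ξ ²) ² ≡ ε
        ξ²α≡αξ²   : generator ξ ² ∙ generator α ≡ generator α ∙ generator ξ ²
        generate  : ∀ {H} → IsSubgroup H → H (generator α) ≡ true → H (generator ξ) ≡ true → ∀ y → H y ≡ true

  module Quotient {n : ℕ} {G : FinGroup n} (gens : SL₂Generators G) where
    open Properties G
    open SL₂Generators gens
    open ≡-Reasoning

    eval : Word → Fin n
    eval []      = ε
    eval (s ∷ w) = generator s ∙ eval w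

    eval-++ : ∀ u v → eval (u ++ v) ≡ eval u ∙ eval v
    eval-++ []      v = sym (identityˡ _)
    eval-++ (s ∷ u) v = trans (cong (generator s ∙_) (eval-++ u v)) (sym (assoc _ _ _))

    relation-holds : ∀ r → eval (proj₁ (relation r)) ≡ eval (proj₂ (relation r))
    relation-holds α³    = trans (cong (λ w → generator α ∙ (generator α ∙ w)) (identityʳ _)) α³≡ε
    relation-holds [αξ]³ = begin
      A ∙ (X ∙ (A ∙ (X ∙ (A ∙ (X ∙ ε)))))  ≡⟨ cong (λ w → A ∙ (X ∙ (A ∙ (X ∙ (A ∙ w))))) (identityʳ X) ⟩
      A ∙ (X ∙ (A ∙ (X ∙ (A ∙ X))))        ≡⟨ solve 2 (λ u v → u ⊕ (v ⊕ (u ⊕ (v ⊕ (u ⊕ v)))) ⊜ (u ⊕ v) ⊕ ((u ⊕ v) ⊕ (u ⊕ v))) refl A X ⟩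
      (A ∙ X) ³                            ≡⟨ [αξ]³≡ε ⟩
      ε                                    ∎
      where A = generator α ; X = generator ξ
    relation-holds ξ⁴    = begin
      X ∙ (X ∙ (X ∙ (X ∙ ε)))  ≡⟨ cong (λ w → X ∙ (X ∙ (X ∙ w))) (identityʳ X) ⟩
      X ∙ (X ∙ (X ∙ X))        ≡⟨ solve 1 (λ u → u ⊕ (u ⊕ (u ⊕ u)) ⊜ (u ⊕ u) ⊕ (u ⊕ u)) refl X ⟩
      (X ²) ²                  ≡⟨ ξ⁴≡ε ⟩
      ε                        ∎
      where X = generator ξ
    relation-holds ξ²α   = begin
      X ∙ (X ∙ (A ∙ ε))  ≡⟨ trans (cong (λ w → X ∙ (X ∙ w)) (identityʳ A)) (sym (assoc X X A)) ⟩
      X ² ∙ A            ≡⟨ ξ²α≡αξ² ⟩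
      A ∙ X ²            ≡⟨ cong (λ w → A ∙ (X ∙ w)) (sym (identityʳ X)) ⟩
      A ∙ (X ∙ (X ∙ ε))  ∎
      where A = generator α ; X = generator ξ

    oriented-holds : ∀ d r → eval (proj₁ (oriented d r)) ≡ eval (proj₂ (oriented d r))
    oriented-holds forward  r = relation-holds r
    oriented-holds backward r = sym (relation-holds r)

    apply-sound : ∀ st w {w′} → apply st w ≡ just w′ → eval w ≡ eval w′
    apply-sound (step k r d) w eq with proj₁ (oriented d r) ≟ᵂ take (length (proj₁ (oriented d r))) (drop k w)
    apply-sound (step k r d) w refl | yes l≡prefix = begin
      eval w                                  ≡⟨ cong eval (sym (take++drop≡id k w)) ⟩
      eval (take k w ++ drop k w)             ≡⟨ cong (λ v → eval (take k w ++ v)) (sym (take++drop≡id (length l) (drop k w))) ⟩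
      eval (take k w ++ (prefix ++ rest))     ≡⟨ cong (λ v → eval (take k w ++ (v ++ rest))) (sym l≡prefix) ⟩
      eval (take k w ++ (l ++ rest))          ≡⟨ trans (eval-++ (take k w) _) (cong (eval (take k w) ∙_) (eval-++ l rest)) ⟩
      eval (take k w) ∙ (eval l ∙ eval rest)  ≡⟨ cong (λ v → eval (take k w) ∙ (v ∙ eval rest)) (oriented-holds d r) ⟩
      eval (take k w) ∙ (eval r′ ∙ eval rest) ≡⟨ sym (trans (eval-++ (take k w) _) (cong (eval (take k w) ∙_) (eval-++ r′ rest))) ⟩
      eval (take k w ++ r′ ++ rest)           ∎
      where
      l = proj₁ (oriented d r)
      r′ = proj₂ (oriented d r)
      prefix = take (length l) (drop k w)
      rest = drop (length l) (drop k w)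

    apply-all-sound : ∀ ss w {w′} → apply-all ss w ≡ just w′ → eval w ≡ eval w′
    apply-all-sound []       w refl = refl
    apply-all-sound (s ∷ ss) w eq with apply s w in eq′
    ... | just w″ = trans (apply-sound s w eq′) (apply-all-sound ss w″ eq)

    rewrites-to-sound : ∀ ss w w′ → rewrites-to ss w w′ ≡ true → eval w ≡ eval w′
    rewrites-to-sound ss w w′ h = apply-all-sound ss w (decided (≡-decᴹ _≟ᵂ_ (apply-all ss w) (just w′)) h)

    φ : M2 → Fin n
    φ m = eval (normal-form m)

    φ-letter : ∀ s → φ (letter-matrix s) ≡ generator s
    φ-letter α = identityʳ (generator α)
    φ-letter ξ = identityʳ (generator ξ)

    φ-∙-letter : ∀ m → det m ≡ i → ∀ s → φ (m · letter-matrix s) ≡ φ m ∙ generator s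
    φ-∙-letter m det≡1 s = begin
      φ (m · letter-matrix s)          ≡⟨ sym (rewrites-to-sound (certificate m s) (normal-form m ++ [ s ]) (normal-form (m · letter-matrix s)) (certificate-valid m det≡1 s)) ⟩
      eval (normal-form m ++ [ s ])    ≡⟨ eval-++ (normal-form m) [ s ] ⟩
      φ m ∙ (generator s ∙ ε)          ≡⟨ cong (φ m ∙_) (identityʳ (generator s)) ⟩
      φ m ∙ generator s                ∎

    φ-∙-evalᴹ : ∀ w m → det m ≡ i → φ (m · evalᴹ w) ≡ φ m ∙ eval w
    φ-∙-evalᴹ []      m det≡1 = trans (cong φ (·-identityʳ m)) (sym (identityʳ _))
    φ-∙-evalᴹ (s ∷ w) m det≡1 = begin
      φ (m · (letter-matrix s · evalᴹ w))  ≡⟨ cong φ (sym (·-assoc m (letter-matrix s) (evalᴹ w))) ⟩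
      φ ((m · letter-matrix s) · evalᴹ w)  ≡⟨ φ-∙-evalᴹ w (m · letter-matrix s) (trans (det-mult m _) (cong₂ _*₃_ det≡1 (det-letter-matrix s))) ⟩
      φ (m · letter-matrix s) ∙ eval w     ≡⟨ cong (_∙ eval w) (φ-∙-letter m det≡1 s) ⟩
      φ m ∙ generator s ∙ eval w           ≡⟨ assoc _ _ _ ⟩
      φ m ∙ (generator s ∙ eval w)         ∎

    φ-∙ : ∀ m m′ → det m ≡ i → det m′ ≡ i → φ (m · m′) ≡ φ m ∙ φ m′
    φ-∙ m m′ det≡1 det′≡1 = trans (cong (λ u → φ (m · u)) (sym (normal-form-correct m′ det′≡1))) (φ-∙-evalᴹ (normal-form m′) m det≡1)

    φ-adj : ∀ m → det m ≡ i → φ (adj m) ≡ φ m ⁻¹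
    φ-adj m det≡1 = inverseˡ-unique (φ (adj m)) (φ m)
      (trans (sym (φ-∙ (adj m) m (trans (det-adj' m) det≡1) det≡1)) (cong φ (adj-inverseˡ m det≡1)))

    Φ : Fin 24 → Fin n
    Φ k = φ (element k)

    image-subgroup : IsSubgroup (image Φ)
    image-subgroup = record
      { ε∈  = in-image I2 refl refl
      ; ∙∈  = λ x∈ y∈ → let (k , eₖ) = image-elim Φ x∈ ; (l , eₗ) = image-elim Φ y∈ in
          in-image (element k · element l) (trans (det-mult (element k) (element l)) (cong₂ _*₃_ (det-element k) (det-element l)))
            (trans (φ-∙ (element k) (element l) (det-element k) (det-element l)) (cong₂ _∙_ eₖ eₗ))
      ; ⁻¹∈ = λ x∈ → let (k , eₖ) = image-elim Φ x∈ in
          in-image (adj (element k)) (trans (det-adj' (element k)) (det-element k))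
            (trans (φ-adj (element k) (det-element k)) (cong _⁻¹ eₖ))
      }
      where
      in-image : ∀ m → det m ≡ i → ∀ {y} → φ m ≡ y → image Φ y ≡ true
      in-image m det≡1 φm≡y with element-surjective m det≡1
      ... | k , eₖ = image-intro Φ k (trans (cong φ eₖ) φm≡y)

    Φ-surjective : ∀ y → ∃ λ k → Φ k ≡ y
    Φ-surjective y = image-elim Φ (generate image-subgroup (generator∈ α) (generator∈ ξ) y)
      where
      generator∈ : ∀ s → image Φ (generator s) ≡ true
      generator∈ s with element-surjective (letter-matrix s) (det-letter-matrix s)
      ... | k , eₖ = image-intro Φ k (trans (cong φ eₖ) (φ-letter s))

  module Isomorphism {G : FinGroup 24} (gens : SL₂Generators G) where
    open Properties G
    open Quotient gens public using (φ)
    open Quotient gens using (Φ; Φ-surjective; φ-∙; φ-adj)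

    Φ-injective : ∀ k l → Φ k ≡ Φ l → k ≡ l
    Φ-injective = surjective⇒injective Φ Φ-surjective

    ψ : Fin 24 → SL₂F₃
    ψ y = element (proj₁ (Φ-surjective y)) , det-element (proj₁ (Φ-surjective y))

    ψ-unique : ∀ y m → det m ≡ i → φ m ≡ y → proj₁ (ψ y) ≡ m
    ψ-unique y m det≡1 φm≡y with element-surjective m det≡1
    ... | k , eₖ = trans (cong element (Φ-injective (proj₁ (Φ-surjective y)) k (trans (proj₂ (Φ-surjective y)) (sym (trans (cong φ eₖ) φm≡y))))) eₖ

    φ-ψ : ∀ y → φ (proj₁ (ψ y)) ≡ y
    φ-ψ y = proj₂ (Φ-surjective y)

    ψ-∙ : ∀ x y → proj₁ (ψ (x ∙ y)) ≡ proj₁ (ψ x) · proj₁ (ψ y)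
    ψ-∙ x y = ψ-unique (x ∙ y) _ (trans (det-mult _ _) (cong₂ _*₃_ (proj₂ (ψ x)) (proj₂ (ψ y))))
      (trans (φ-∙ _ _ (proj₂ (ψ x)) (proj₂ (ψ y))) (cong₂ _∙_ (φ-ψ x) (φ-ψ y)))

    ψ-ε : proj₁ (ψ ε) ≡ I2
    ψ-ε = ψ-unique ε I2 refl refl

    ψ-⁻¹ : ∀ x → proj₁ (ψ (x ⁻¹)) ≡ adj (proj₁ (ψ x))
    ψ-⁻¹ x = ψ-unique (x ⁻¹) _ (trans (det-adj' _) (proj₂ (ψ x))) (trans (φ-adj _ (proj₂ (ψ x))) (cong _⁻¹ (φ-ψ x)))

    ψ-injective : ∀ x y → proj₁ (ψ x) ≡ proj₁ (ψ y) → x ≡ y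
    ψ-injective x y eq = trans (sym (φ-ψ x)) (trans (cong φ eq) (φ-ψ y))

open import Defs using (GeneratedBy; HasOddOrder)
open FiniteGroup using (FinGroup)

module Order24 (G : FinGroup 24) (generated : GeneratedBy (FinGroup.group G) (HasOddOrder (FinGroup.group G))) where

  open import Data.Nat.Base using (ℕ; zero; suc; _+_; _*_; _≤_; _<_; s≤s; z≤n; _%_)
  open import Data.Nat.Properties using (_≟_; _≤?_; _<?_; ≤-trans; ≤-reflexive; <-irrefl; n≤1+n; *-comm; *-cancelˡ-≡)
  open import Data.Nat.Divisibility using (_∣_; divides; _∣?_; ∣⇒≤)
  open import Data.Fin.Base using (Fin; zero; suc; toℕ; fromℕ<)
  open import Data.Fin.Properties using (all?; toℕ-fromℕ<) renaming (_≟_ to _≟ᶠ_)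
  open import Data.Bool.Base using (Bool; true; false; not; _∧_; _∨_)
  open import Data.Bool.Properties using (¬-not)
  open import Data.Product using (∃; ∃₂; _×_; _,_; proj₁; proj₂)
  open import Data.Sum using (_⊎_; inj₁; inj₂; [_,_]; [_,_]′)
  open import Data.Empty using (⊥; ⊥-elim)
  open import Function.Base using (case_of_)
  open import Relation.Nullary using (yes; no)
  open import Relation.Nullary.Decidable using (True; toWitness; _→-dec_; _⊎-dec_; ¬?)
  open import Relation.Unary using (Decidable)
  open import Relation.Binary.PropositionalEquality hiding ([_])
  open FiniteGroup using (module Properties)
  open Counting
  open Presentation using (SL₂Generators; α; ξ)

  open Properties G
  open Generated generated
  open ≡-Reasoning

  by-decision : ∀ {P : ℕ → Set} (P? : Decidable P) N →
    True (all? (λ (k : Fin N) → P? (toℕ k))) → ∀ {m} → m < N → P m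
  by-decision {P} P? N holds m<N = subst P (toℕ-fromℕ< m<N) (toWitness holds (fromℕ< m<N))

  opaque
    odd-divisor-of-24 : ∀ {m} → m ∣ 24 → m % 2 ≡ 1 → m ≡ 1 ⊎ m ≡ 3
    odd-divisor-of-24 m∣24 =
      by-decision (λ m → m ∣? 24 →-dec m % 2 ≟ 1 →-dec (m ≟ 1 ⊎-dec m ≟ 3)) 25 _ (s≤s (∣⇒≤ m∣24)) m∣24

    large-divisor-of-24 : ∀ {m} → m ∣ 24 → 9 ≤ m → m ≢ 12 → m ≡ 24
    large-divisor-of-24 m∣24 =
      by-decision (λ m → m ∣? 24 →-dec 9 ≤? m →-dec ¬? (m ≟ 12) →-dec m ≟ 24) 25 _ (s≤s (∣⇒≤ m∣24)) m∣24

    multiple-of-9<24 : ∀ {m} → m ≤ 24 → 9 ∣ m → m < 24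
    multiple-of-9<24 m≤24 = by-decision (λ m → 9 ∣? m →-dec m <? 24) 25 _ (s≤s m≤24)

    count-constraints⇒6 : ∀ {r} → r ≤ 24 → 1 ≤ r → 3 ∣ r → 2 ∣ 2 + r → 2 + r ∣ 48 → r ≡ 6
    count-constraints⇒6 r≤24 = by-decision (λ r → 1 ≤? r →-dec 3 ∣? r →-dec 2 ∣? 2 + r →-dec 2 + r ∣? 48 →-dec r ≟ 6) 25 _ (s≤s r≤24)

  odd-order⇒ε∨³≡ε : ∀ {g} → HasOddOrder group g → g ≡ ε ⊎ g ³ ≡ ε
  odd-order⇒ε∨³≡ε {g} (m , order@(_ , gᵐ≡ε , _) , odd) with odd-divisor-of-24 (order∣size order) odd
  ... | inj₁ refl = inj₁ (trans (sym (identityʳ g)) gᵐ≡ε)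
  ... | inj₂ refl = inj₂ (trans (cong (λ w → g ∙ (g ∙ w)) (sym (identityʳ g))) gᵐ≡ε)

  order3-induction : (P : Fin 24 → Set) → P ε → (∀ {x y} → P x → P y → P (x ∙ y)) →
    (∀ {x} → P x → P (x ⁻¹)) → (∀ {x} → order3 x ≡ true → P x) → ∀ g → P g
  order3-induction P ε∈ ∙∈ ⁻¹∈ order3∈ = generated-induction P ε∈ ∙∈ ⁻¹∈ odd∈
    where
    odd∈ : ∀ {g} → HasOddOrder group g → P g
    odd∈ {g} odd with odd-order⇒ε∨³≡ε odd
    ... | inj₁ g≡ε = subst P (sym g≡ε) ε∈
    ... | inj₂ g³≡ε with g == ε in g≟ε
    ...   | true  = subst P (sym (==⇒≡ g≟ε)) ε∈
    ...   | false = order3∈ (order3-intro g³≡ε (λ g≡ε → true≢false (trans (sym (≡⇒== g≡ε)) g≟ε)))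

  ∃order3 : ∃ λ a → order3 a ≡ true
  ∃order3 with search order3
  ... | inj₁ found = found
  ... | inj₂ none = ⊥-elim (0≢1 (trans (all-ε zero) (sym (all-ε (suc zero)))))
    where
    0≢1 : _≡_ {A = Fin 24} zero (suc zero) → ⊥
    0≢1 ()
    all-ε : ∀ y → y ≡ ε
    all-ε = order3-induction (_≡ ε) refl (λ x≡ε y≡ε → trans (cong₂ _∙_ x≡ε y≡ε) (identityˡ ε))
      (λ x≡ε → trans (cong _⁻¹ x≡ε) ε⁻¹≈ε) (λ {x} o → ⊥-elim (true≢false (trans (sym o) (none x))))

  ∃order3∉⟨⟩₃ : ∀ {a} → order3 a ≡ true → ∃ λ b → order3 b ≡ true × ⟨ a ⟩₃ b ≡ false
  ∃order3∉⟨⟩₃ {a} order3-a with search (λ b → order3 b ∧ not (⟨ a ⟩₃ b))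
  ... | inj₁ (b , h) = b , proj₁ (∧-elim {order3 b} h) , not-elim (proj₂ (∧-elim {order3 b} h))
  ... | inj₂ none = ⊥-elim (<-irrefl refl (≤-trans (s≤s (≤-trans (≤-reflexive (sym ⟨a⟩-everything)) (count-⟨⟩₃≤3 a)))
                                                    (s≤s (s≤s (s≤s (s≤s z≤n))))))
    where
    open Order3 order3-a
    in-⟨a⟩ : ∀ {x} → order3 x ≡ true → ⟨ a ⟩₃ x ≡ true
    in-⟨a⟩ {x} o with ⟨ a ⟩₃ x in x∈
    ... | true  = refl
    ... | false = ⊥-elim (true≢false (trans (sym (∧-intro o (not-intro x∈))) (none x)))
    ⟨a⟩-everything : count ⟨ a ⟩₃ ≡ 24
    ⟨a⟩-everything = trans (count-cong (order3-induction (λ y → ⟨ a ⟩₃ y ≡ true) (ε∈⟨⟩₃ a) ⟨⟩₃-∙ ⟨⟩₃-⁻¹ in-⟨a⟩))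
                           (count-true 24)

  -- Two subgroups of order 3

  module TwoSubgroups {p t : Fin 24} (order3-p : order3 p ≡ true) (order3-t : order3 t ≡ true)
                      (t∉⟨p⟩ : ⟨ p ⟩₃ t ≡ false) where
    private
      module P = Order3 order3-p
      module T = Order3 order3-t

    ⟨p⟩∩⟨t⟩≡ε : ∀ {y} → ⟨ p ⟩₃ y ≡ true → ⟨ t ⟩₃ y ≡ true → y ≡ ε
    ⟨p⟩∩⟨t⟩≡ε {y} y∈⟨p⟩ y∈⟨t⟩ with ⟨⟩₃-elim {t} {y} y∈⟨t⟩
    ... | inj₁ y≡ε        = y≡ε
    ... | inj₂ (inj₁ refl) = ⊥-elim (true≢false (trans (sym y∈⟨p⟩) t∉⟨p⟩))
    ... | inj₂ (inj₂ refl) = ⊥-elim (true≢false (trans (sym (∈-resp ⟨ p ⟩₃ T.²²≡ (P.⟨⟩₃-∙ y∈⟨p⟩ y∈⟨p⟩))) t∉⟨p⟩))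

    products : Fin 3 → Fin 3 → Fin 24
    products i j = power₃ p i ∙ power₃ t j

    products-injective : ∀ i j k l → products i j ≡ products k l → i ≡ k × j ≡ l
    products-injective i j k l eq =
      P.power₃-injective i k (∙-cancelˡ (power₃ p k ⁻¹) _ _ (trans meet (sym (inverseˡ _)))) ,
      sym (T.power₃-injective l j (∙-cancelʳ (power₃ t j ⁻¹) _ _ (trans (trans (sym swapped) meet) (sym (inverseʳ _)))))
      where
      swapped : power₃ p k ⁻¹ ∙ power₃ p i ≡ power₃ t l ∙ power₃ t j ⁻¹
      swapped = ∙≡∙⇒⁻¹∙≡∙⁻¹ eq
      meet : power₃ p k ⁻¹ ∙ power₃ p i ≡ ε
      meet = ⟨p⟩∩⟨t⟩≡ε (P.⟨⟩₃-∙ (P.⟨⟩₃-⁻¹ (power₃∈⟨⟩₃ p k)) (power₃∈⟨⟩₃ p i))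
                       (∈-resp ⟨ t ⟩₃ (sym swapped) (T.⟨⟩₃-∙ (power₃∈⟨⟩₃ t l) (T.⟨⟩₃-⁻¹ (power₃∈⟨⟩₃ t j))))

    count-products : count (image₂ products) ≡ 9
    count-products = count-image₂-injective products products-injective

    generate : ∀ {H} → IsSubgroup H → H p ≡ true → H t ≡ true → ∀ y → H y ≡ true
    generate {H} S p∈H t∈H = count≥size⇒all H (≤-reflexive (sym count-H≡24))
      where
      open IsSubgroup S
      power₃∈H : ∀ q → H q ≡ true → ∀ i → H (power₃ q i) ≡ true
      power₃∈H q q∈H zero             = ε∈
      power₃∈H q q∈H (suc zero)       = q∈H
      power₃∈H q q∈H (suc (suc zero)) = ∙∈ q∈H q∈H
      9≤count-H : 9 ≤ count H
      9≤count-H = subst (_≤ count H) count-products (count-mono λ y y∈ →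
        let (i , j , eq) = image₂-elim products y∈ in
        ∈-resp H eq (∙∈ (power₃∈H p p∈H i) (power₃∈H t t∈H j)))
      count-H≡24 : count H ≡ 24
      count-H≡24 = large-divisor-of-24 (lagrange S) 9≤count-H (λ eq → no-index-2 S (cong₂ _+_ eq eq))

    ∈products : ∀ {u v} → ⟨ p ⟩₃ u ≡ true → ⟨ t ⟩₃ v ≡ true → image₂ products (u ∙ v) ≡ true
    ∈products {u} {v} u∈ v∈ with ∈⟨⟩₃⇒power₃ p {u} u∈ | ∈⟨⟩₃⇒power₃ t {v} v∈
    ... | i , refl | j , refl = image₂-intro products i j refl

    ∈products-elim : ∀ {y} → image₂ products y ≡ true →
      ∃₂ λ u v → ⟨ p ⟩₃ u ≡ true × ⟨ t ⟩₃ v ≡ true × u ∙ v ≡ y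
    ∈products-elim y∈ with image₂-elim products y∈
    ... | i , j , eq = power₃ p i , power₃ t j , power₃∈⟨⟩₃ p i , power₃∈⟨⟩₃ t j , eq

    module _ (normal : ⟨ p ⟩₃ (conj t p) ≡ true) where

      conj-t-⟨p⟩ : ∀ {u} → ⟨ p ⟩₃ u ≡ true → ⟨ p ⟩₃ (conj t u) ≡ true
      conj-t-⟨p⟩ {u} u∈ with ⟨⟩₃-elim {p} {u} u∈
      ... | inj₁ refl        = ∈-resp ⟨ p ⟩₃ (sym (conj-ε t)) (ε∈⟨⟩₃ p)
      ... | inj₂ (inj₁ refl) = normal
      ... | inj₂ (inj₂ refl) = ∈-resp ⟨ p ⟩₃ (sym (conj-² t p)) (P.⟨⟩₃-∙ normal normal)

      conj-⟨t⟩-⟨p⟩ : ∀ {v u} → ⟨ t ⟩₃ v ≡ true → ⟨ p ⟩₃ u ≡ true → ⟨ p ⟩₃ (conj v u) ≡ true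
      conj-⟨t⟩-⟨p⟩ {v} {u} v∈ u∈ with ⟨⟩₃-elim {t} {v} v∈
      ... | inj₁ refl        = ∈-resp ⟨ p ⟩₃ (sym (conj-by-ε u)) u∈
      ... | inj₂ (inj₁ refl) = conj-t-⟨p⟩ u∈
      ... | inj₂ (inj₂ refl) = ∈-resp ⟨ p ⟩₃ (conj-conj t t u) (conj-t-⟨p⟩ (conj-t-⟨p⟩ u∈))

      products-subgroup : IsSubgroup (image₂ products)
      products-subgroup = record
        { ε∈  = ∈-resp (image₂ products) (identityˡ ε) (∈products (ε∈⟨⟩₃ p) (ε∈⟨⟩₃ t))
        ; ∙∈  = λ x∈ y∈ →
            let (u , v , u∈ , v∈ , eq) = ∈products-elim x∈ ; (u′ , v′ , u′∈ , v′∈ , eq′) = ∈products-elim y∈ in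
            ∈-resp (image₂ products) (trans (regroup u v u′ v′) (cong₂ _∙_ eq eq′))
              (∈products (P.⟨⟩₃-∙ u∈ (conj-⟨t⟩-⟨p⟩ v∈ u′∈)) (T.⟨⟩₃-∙ v∈ v′∈))
        ; ⁻¹∈ = λ x∈ →
            let (u , v , u∈ , v∈ , eq) = ∈products-elim x∈ in
            ∈-resp (image₂ products) (trans (invert u v) (cong _⁻¹ eq))
              (∈products (conj-⟨t⟩-⟨p⟩ (T.⟨⟩₃-⁻¹ v∈) (P.⟨⟩₃-⁻¹ u∈)) (T.⟨⟩₃-⁻¹ v∈))
        }
        where
        regroup : ∀ u v u′ v′ → u ∙ conj v u′ ∙ (v ∙ v′) ≡ u ∙ v ∙ (u′ ∙ v′)
        regroup u v u′ v′ = begin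
          u ∙ (v ∙ u′ ∙ v ⁻¹) ∙ (v ∙ v′)  ≡⟨ solve 5 (λ a b c d f → (a ⊕ ((b ⊕ c) ⊕ d)) ⊕ (b ⊕ f) ⊜ ((a ⊕ b) ⊕ c) ⊕ ((d ⊕ b) ⊕ f)) refl u v u′ (v ⁻¹) v′ ⟩
          u ∙ v ∙ u′ ∙ (v ⁻¹ ∙ v ∙ v′)   ≡⟨ cong (λ w → u ∙ v ∙ u′ ∙ (w ∙ v′)) (inverseˡ v) ⟩
          u ∙ v ∙ u′ ∙ (ε ∙ v′)          ≡⟨ cong (u ∙ v ∙ u′ ∙_) (identityˡ v′) ⟩
          u ∙ v ∙ u′ ∙ v′                ≡⟨ assoc _ _ _ ⟩
          u ∙ v ∙ (u′ ∙ v′)              ∎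
        invert : ∀ u v → conj (v ⁻¹) (u ⁻¹) ∙ v ⁻¹ ≡ (u ∙ v) ⁻¹
        invert u v = begin
          v ⁻¹ ∙ u ⁻¹ ∙ v ⁻¹ ⁻¹ ∙ v ⁻¹   ≡⟨ //-rightDividesˡ (v ⁻¹) (v ⁻¹ ∙ u ⁻¹) ⟩
          v ⁻¹ ∙ u ⁻¹                    ≡⟨ sym (⁻¹-anti-homo-∙ u v) ⟩
          (u ∙ v) ⁻¹                     ∎

    ⟨p⟩-not-normal : ⟨ p ⟩₃ (conj t p) ≡ false
    ⟨p⟩-not-normal = ¬-not λ normal → 9≢24 (begin
      9                          ≡⟨ sym count-products ⟩
      count (image₂ products)    ≡⟨ count-cong (generate (products-subgroup normal) p∈ t∈) ⟩
      count (λ _ → true)         ≡⟨ count-true 24 ⟩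
      24                         ∎)
      where
      9≢24 : 9 ≢ 24
      9≢24 ()
      p∈ = ∈-resp (image₂ products) (identityʳ p) (∈products (p∈⟨p⟩₃ p) (ε∈⟨⟩₃ t))
      t∈ = ∈-resp (image₂ products) (identityˡ t) (∈products (ε∈⟨⟩₃ p) (p∈⟨p⟩₃ t))

  -- Conjugacy of the subgroups of order 3

  module _ {a t : Fin 24} (order3-a : order3 a ≡ true) (order3-t : order3 t ≡ true) where
    private
      module A = Order3 order3-a
      module T = Order3 order3-t

    -- R is a union of double cosets ⟨t⟩ x ⟨a⟩, each of size 9, so it cannot be all of G.
    private
      R : Fin 24 → Bool
      R x = not (⟨ a ⟩₃ (conj (x ⁻¹) t))

      double-coset : Fin 24 → Fin 3 → Fin 3 → Fin 24
      double-coset x i j = power₃ t i ∙ x ∙ power₃ a j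

      ∈double-coset : ∀ x {u v} → ⟨ t ⟩₃ u ≡ true → ⟨ a ⟩₃ v ≡ true → image₂ (double-coset x) (u ∙ x ∙ v) ≡ true
      ∈double-coset x {u} {v} u∈ v∈ with ∈⟨⟩₃⇒power₃ t {u} u∈ | ∈⟨⟩₃⇒power₃ a {v} v∈
      ... | i , refl | j , refl = image₂-intro (double-coset x) i j refl

      ∈double-coset-elim : ∀ x {y} → image₂ (double-coset x) y ≡ true →
        ∃₂ λ u v → ⟨ t ⟩₃ u ≡ true × ⟨ a ⟩₃ v ≡ true × u ∙ x ∙ v ≡ y
      ∈double-coset-elim x y∈ with image₂-elim (double-coset x) y∈
      ... | i , j , eq = power₃ t i , power₃ a j , power₃∈⟨⟩₃ t i , power₃∈⟨⟩₃ a j , eq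

      ⁻¹-conj-double : ∀ u x v → conj ((u ∙ x ∙ v) ⁻¹) t ≡ conj (v ⁻¹) (conj (x ⁻¹) (conj (u ⁻¹) t))
      ⁻¹-conj-double u x v = begin
        conj ((u ∙ x ∙ v) ⁻¹) t                   ≡⟨ cong (λ w → conj w t) (trans (⁻¹-anti-homo-∙ (u ∙ x) v) (cong (v ⁻¹ ∙_) (⁻¹-anti-homo-∙ u x))) ⟩
        conj (v ⁻¹ ∙ (x ⁻¹ ∙ u ⁻¹)) t             ≡⟨ sym (conj-conj (v ⁻¹) (x ⁻¹ ∙ u ⁻¹) t) ⟩
        conj (v ⁻¹) (conj (x ⁻¹ ∙ u ⁻¹) t)        ≡⟨ cong (conj (v ⁻¹)) (sym (conj-conj (x ⁻¹) (u ⁻¹) t)) ⟩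
        conj (v ⁻¹) (conj (x ⁻¹) (conj (u ⁻¹) t)) ∎

      R-closed : ∀ x y → R x ≡ true → image₂ (double-coset x) y ≡ true → R y ≡ true
      R-closed x y x∈R y∈ with ∈double-coset-elim x y∈
      ... | u , v , u∈ , v∈ , refl = not-intro (¬-not λ h → true≢false (trans (sym (x∈ h)) (not-elim x∈R)))
        where
        x∈ : ⟨ a ⟩₃ (conj ((u ∙ x ∙ v) ⁻¹) t) ≡ true → ⟨ a ⟩₃ (conj (x ⁻¹) t) ≡ true
        x∈ h = ∈-resp ⟨ a ⟩₃ (trans (conj-conj-⁻¹ v _) (cong (conj (x ⁻¹)) (comm⇒conj≡ (u ⁻¹) t
                                   (⟨⟩₃-comm (T.⟨⟩₃-⁻¹ u∈) (p∈⟨p⟩₃ t)))))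
                 (A.⟨⟩₃-conj v∈ (∈-resp ⟨ a ⟩₃ (⁻¹-conj-double u x v) h))

      double-coset-trans : ∀ x y z → image₂ (double-coset x) y ≡ true →
        image₂ (double-coset y) z ≡ image₂ (double-coset x) z
      double-coset-trans x y z y∈ with ∈double-coset-elim x y∈
      ... | u , v , u∈ , v∈ , refl = bool-ext
        (λ z∈ → let (u′ , v′ , u′∈ , v′∈ , eq) = ∈double-coset-elim (u ∙ x ∙ v) z∈ in
          ∈-resp (image₂ (double-coset x)) (trans (sym (regroup u′ u x v v′)) eq) (∈double-coset x (T.⟨⟩₃-∙ u′∈ u∈) (A.⟨⟩₃-∙ v∈ v′∈)))
        (λ z∈ → let (u′ , v′ , u′∈ , v′∈ , eq) = ∈double-coset-elim x z∈ in
          ∈-resp (image₂ (double-coset (u ∙ x ∙ v)))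
            (trans (regroup (u′ ∙ u ⁻¹) u x v (v ⁻¹ ∙ v′))
                   (trans (cong₂ (λ p q → p ∙ x ∙ q) (//-rightDividesˡ u u′) (∙[⁻¹∙] v v′)) eq))
            (∈double-coset (u ∙ x ∙ v) (T.⟨⟩₃-∙ u′∈ (T.⟨⟩₃-⁻¹ u∈)) (A.⟨⟩₃-∙ (A.⟨⟩₃-⁻¹ v∈) v′∈)))
        where
        regroup : ∀ u′ u x v v′ → u′ ∙ (u ∙ x ∙ v) ∙ v′ ≡ u′ ∙ u ∙ x ∙ (v ∙ v′)
        regroup u′ u x v v′ = solve 5 (λ a₁ a₂ a₃ a₄ a₅ → (a₁ ⊕ ((a₂ ⊕ a₃) ⊕ a₄)) ⊕ a₅ ⊜ ((a₁ ⊕ a₂) ⊕ a₃) ⊕ (a₄ ⊕ a₅)) refl u′ u x v v′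

      conj-generator : ∀ {g w} → ⟨ t ⟩₃ w ≡ true → w ≢ ε → ⟨ a ⟩₃ (conj g w) ≡ true → ⟨ a ⟩₃ (conj g t) ≡ true
      conj-generator {g} {w} w∈ w≢ε h = A.⟨⟩₃-⊆ {conj g w} {conj g t} h (conj-∈⟨⟩₃ g {w} {t} (T.⟨⟩₃-generator {w} w∈ w≢ε))

      double-coset-injective : ∀ x → R x ≡ true → ∀ i j k l → double-coset x i j ≡ double-coset x k l → i ≡ k × j ≡ l
      double-coset-injective x x∈R i j k l eq = i≡k , j≡l
        where
        w = power₃ t k ⁻¹ ∙ power₃ t i
        swapped : (power₃ t k ∙ x) ⁻¹ ∙ (power₃ t i ∙ x) ≡ power₃ a l ∙ power₃ a j ⁻¹
        swapped = ∙≡∙⇒⁻¹∙≡∙⁻¹ eq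
        lhs : (power₃ t k ∙ x) ⁻¹ ∙ (power₃ t i ∙ x) ≡ conj (x ⁻¹) w
        lhs = begin
          (power₃ t k ∙ x) ⁻¹ ∙ (power₃ t i ∙ x)           ≡⟨ cong₂ (λ p q → p ∙ (power₃ t i ∙ q)) (⁻¹-anti-homo-∙ (power₃ t k) x) (sym (⁻¹-involutive x)) ⟩
          x ⁻¹ ∙ power₃ t k ⁻¹ ∙ (power₃ t i ∙ x ⁻¹ ⁻¹)    ≡⟨ solve 4 (λ a₁ a₂ a₃ a₄ → (a₁ ⊕ a₂) ⊕ (a₃ ⊕ a₄) ⊜ (a₁ ⊕ (a₂ ⊕ a₃)) ⊕ a₄) refl (x ⁻¹) (power₃ t k ⁻¹) (power₃ t i) (x ⁻¹ ⁻¹) ⟩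
          x ⁻¹ ∙ w ∙ x ⁻¹ ⁻¹                               ∎
        w≡ε : w ≡ ε
        w≡ε = ≡-stable λ w≢ε → true≢false (trans (sym (conj-generator
          (T.⟨⟩₃-∙ (T.⟨⟩₃-⁻¹ (power₃∈⟨⟩₃ t k)) (power₃∈⟨⟩₃ t i)) w≢ε
          (∈-resp ⟨ a ⟩₃ (trans (sym swapped) lhs) (A.⟨⟩₃-∙ (power₃∈⟨⟩₃ a l) (A.⟨⟩₃-⁻¹ (power₃∈⟨⟩₃ a j))))))
          (not-elim x∈R))
        i≡k : i ≡ k
        i≡k = T.power₃-injective i k (∙-cancelˡ (power₃ t k ⁻¹) _ _ (trans w≡ε (sym (inverseˡ _))))
        j≡l : j ≡ l
        j≡l = sym (A.power₃-injective l j (∙-cancelʳ (power₃ a j ⁻¹) _ _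
          (trans (sym swapped) (trans lhs (trans (cong (conj (x ⁻¹)) w≡ε) (trans (conj-ε (x ⁻¹)) (sym (inverseʳ _))))))))

    conjugate-into : ∃ λ g → ⟨ a ⟩₃ (conj g t) ≡ true
    conjugate-into with count<size⇒false R (multiple-of-9<24 (count-≤-size R) 9∣count-R)
      where
      9∣count-R : 9 ∣ count R
      9∣count-R = uniform-partition⇒∣count (λ x → image₂ (double-coset x)) 9 (suc (count R)) R (n≤1+n _)
        (λ x _ → ∈-resp (image₂ (double-coset x)) (trans (identityʳ _) (identityˡ x)) (∈double-coset x (ε∈⟨⟩₃ t) (ε∈⟨⟩₃ a)))
        R-closed (λ x y z _ → double-coset-trans x y z)
        (λ x x∈R → count-image₂-injective (double-coset x) (double-coset-injective x x∈R))
    ... | x , x∉R = x ⁻¹ , not-false x∉R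
      where
      not-false : ∀ {b} → not b ≡ false → b ≡ true
      not-false {true} _ = refl

  -- Counting the elements of order 3

  not⟨⟩₃-sym : ∀ {p t} → order3 p ≡ true → order3 t ≡ true → ⟨ p ⟩₃ t ≡ false → ⟨ t ⟩₃ p ≡ false
  not⟨⟩₃-sym order3-p order3-t t∉⟨p⟩ = ¬-not λ p∈⟨t⟩ →
    true≢false (trans (sym (Order3.⟨⟩₃-generator order3-t p∈⟨t⟩ (order3⇒≢ε order3-p))) t∉⟨p⟩)

  module Outside {a : Fin 24} (order3-a : order3 a ≡ true) where
    private
      module A = Order3 order3-a

    outside : Fin 24 → Bool
    outside y = order3 y ∧ not (⟨ a ⟩₃ y)

    outside-intro : ∀ {y} → order3 y ≡ true → ⟨ a ⟩₃ y ≡ false → outside y ≡ true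
    outside-intro o y∉ = ∧-intro o (not-intro y∉)

    outside⇒order3 : ∀ {y} → outside y ≡ true → order3 y ≡ true
    outside⇒order3 {y} h = proj₁ (∧-elim {order3 y} h)

    outside⇒∉⟨a⟩ : ∀ {y} → outside y ≡ true → ⟨ a ⟩₃ y ≡ false
    outside⇒∉⟨a⟩ {y} h = not-elim (proj₂ (∧-elim {order3 y} h))

    conj-a-outside : ∀ {y} → outside y ≡ true → outside (conj a y) ≡ true
    conj-a-outside {y} h = outside-intro (order3-conj a (outside⇒order3 h)) (¬-not λ ay∈ → true≢false
      (trans (sym (∈-resp ⟨ a ⟩₃ (conj-⁻¹-conj a y) (A.⟨⟩₃-conj (A.⟨⟩₃-⁻¹ (p∈⟨p⟩₃ a)) ay∈))) (outside⇒∉⟨a⟩ h)))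

    conj-a³≡id : ∀ x → conj a (conj a (conj a x)) ≡ x
    conj-a³≡id x = begin
      conj a (conj a (conj a x))  ≡⟨ cong (conj a) (conj-conj a a x) ⟩
      conj a (conj (a ∙ a) x)     ≡⟨ conj-conj a (a ∙ a) x ⟩
      conj (a ³) x                ≡⟨ cong (λ w → conj w x) (order3⇒³≡ε order3-a) ⟩
      conj ε x                    ≡⟨ conj-by-ε x ⟩
      x                           ∎

    conj-a-no-fixed-point : ∀ {y} → outside y ≡ true → conj a y ≢ y
    conj-a-no-fixed-point {y} h ay≡y = true≢false (trans (sym (∈-resp ⟨ y ⟩₃ (sym ay≡y) (p∈⟨p⟩₃ y)))
      (TwoSubgroups.⟨p⟩-not-normal (outside⇒order3 h) order3-a (not⟨⟩₃-sym order3-a (outside⇒order3 h) (outside⇒∉⟨a⟩ h))))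

    3∣count-outside : 3 ∣ count outside
    3∣count-outside = order3⇒3∣count (conj a) outside conj-a-outside conj-a-no-fixed-point conj-a³≡id

    2∣count-order3 : 2 ∣ count order3
    2∣count-order3 = involution⇒2∣count _⁻¹ order3 order3-⁻¹ no-fixed-point ⁻¹-involutive
      where
      order3-⁻¹ : ∀ {x} → order3 x ≡ true → order3 (x ⁻¹) ≡ true
      order3-⁻¹ {x} o = order3-intro
        (trans (sym (trans (⁻¹-anti-homo-∙ x (x ∙ x)) (trans (cong (_∙ x ⁻¹) (⁻¹-anti-homo-∙ x x)) (assoc _ _ _))))
               (trans (cong _⁻¹ (order3⇒³≡ε o)) ε⁻¹≈ε))
        (λ x⁻¹≡ε → order3⇒≢ε o (⁻¹-injective (trans x⁻¹≡ε (sym ε⁻¹≈ε))))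
      no-fixed-point : ∀ {x} → order3 x ≡ true → x ⁻¹ ≢ x
      no-fixed-point {x} o x⁻¹≡x = order3⇒≢ε o (begin
        x               ≡⟨ sym (identityʳ x) ⟩
        x ∙ ε           ≡⟨ cong (x ∙_) (sym (inverseʳ x)) ⟩
        x ∙ (x ∙ x ⁻¹)  ≡⟨ cong (λ w → x ∙ (x ∙ w)) x⁻¹≡x ⟩
        x ³             ≡⟨ order3⇒³≡ε o ⟩
        ε               ∎)

    count-order3∩⟨a⟩ : count (λ y → order3 y ∧ ⟨ a ⟩₃ y) ≡ 2
    count-order3∩⟨a⟩ = trans (count-cong (λ y → bool-ext (⇒ y) (⇐ y))) (count-pair (λ a≡a² → A.²≢ A.p≢ε (sym a≡a²)))
      where
      ⇒ : ∀ y → order3 y ∧ ⟨ a ⟩₃ y ≡ true → (y == a) ∨ (y == a ²) ≡ true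
      ⇒ y h with ∧-elim {order3 y} h
      ... | o , y∈ with ⟨⟩₃-elim {a} {y} y∈
      ...   | inj₁ y≡ε        = ⊥-elim (order3⇒≢ε o y≡ε)
      ...   | inj₂ (inj₁ y≡a) = ∨-introˡ _ (≡⇒== y≡a)
      ...   | inj₂ (inj₂ y≡a²) = ∨-introʳ (y == a) (≡⇒== y≡a²)
      ⇐ : ∀ y → (y == a) ∨ (y == a ²) ≡ true → order3 y ∧ ⟨ a ⟩₃ y ≡ true
      ⇐ y h with ∨-elim {y == a} h
      ... | inj₁ e = subst (λ w → order3 w ∧ ⟨ a ⟩₃ w ≡ true) (sym (==⇒≡ e)) (∧-intro order3-a (p∈⟨p⟩₃ a))
      ... | inj₂ e = subst (λ w → order3 w ∧ ⟨ a ⟩₃ w ≡ true) (sym (==⇒≡ e)) (∧-intro A.order3-² (p²∈⟨p⟩₃ a))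

    count-order3≡2+outside : count order3 ≡ 2 + count outside
    count-order3≡2+outside = trans (count-∧-split order3 ⟨ a ⟩₃) (cong (_+ count outside) count-order3∩⟨a⟩)

    normaliser : Fin 24 → Bool
    normaliser y = ⟨ a ⟩₃ (conj y a)

    -- Double counting the pairs (t, x) with t of order 3 and x⁻¹ t x ∈ ⟨a⟩.

    count-order3*normaliser : count order3 * count normaliser ≡ 48
    count-order3*normaliser = double-count incidence order3 row
      (λ t o → count-false (incidence t) (λ x → cong (_∧ ⟨ a ⟩₃ (conj (x ⁻¹) t)) o)) column
      where
      incidence : Fin 24 → Fin 24 → Bool
      incidence t x = order3 t ∧ ⟨ a ⟩₃ (conj (x ⁻¹) t)
      column : ∀ x → count (λ t → incidence t x) ≡ 2
      column x = trans (count-cong (λ t → bool-ext (⇒ t) (⇐ t)))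
                       (count-pair (λ eq → A.²≢ A.p≢ε (sym (conj-injective x eq))))
        where
        ⇒ : ∀ t → incidence t x ≡ true → (t == conj x a) ∨ (t == conj x (a ²)) ≡ true
        ⇒ t h with ∧-elim {order3 t} h
        ... | o , h′ with ⟨⟩₃-elim {a} {conj (x ⁻¹) t} h′
        ...   | inj₁ eq        = ⊥-elim (order3⇒≢ε (order3-conj (x ⁻¹) o) eq)
        ...   | inj₂ (inj₁ eq) = ∨-introˡ _ (≡⇒== (trans (sym (conj-conj-⁻¹ x t)) (cong (conj x) eq)))
        ...   | inj₂ (inj₂ eq) = ∨-introʳ (t == conj x a) (≡⇒== (trans (sym (conj-conj-⁻¹ x t)) (cong (conj x) eq)))
        ⇐ : ∀ t → (t == conj x a) ∨ (t == conj x (a ²)) ≡ true → incidence t x ≡ true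
        ⇐ t h with ∨-elim {t == conj x a} h
        ... | inj₁ e = subst (λ w → incidence w x ≡ true) (sym (==⇒≡ e))
                         (∧-intro (order3-conj x order3-a) (∈-resp ⟨ a ⟩₃ (sym (conj-⁻¹-conj x a)) (p∈⟨p⟩₃ a)))
        ... | inj₂ e = subst (λ w → incidence w x ≡ true) (sym (==⇒≡ e))
                         (∧-intro (order3-conj x A.order3-²) (∈-resp ⟨ a ⟩₃ (sym (conj-⁻¹-conj x (a ²))) (p²∈⟨p⟩₃ a)))
      row : ∀ t → order3 t ≡ true → count (incidence t) ≡ count normaliser
      row t o with conjugate-into order3-a o
      ... | g , s∈ = trans (count-cong (λ x → trans (cong (_∧ ⟨ a ⟩₃ (conj (x ⁻¹) t)) o) (shift x)))
                           (count-permute normaliser (λ x → (g ∙ x) ⁻¹) (λ y → g ⁻¹ ∙ y ⁻¹) f∘g f∘g′)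
        where
        s = conj g t
        f∘g : ∀ y → (g ∙ (g ⁻¹ ∙ y ⁻¹)) ⁻¹ ≡ y
        f∘g y = trans (cong _⁻¹ (∙[⁻¹∙] g (y ⁻¹))) (⁻¹-involutive y)
        f∘g′ : ∀ x → g ⁻¹ ∙ (g ∙ x) ⁻¹ ⁻¹ ≡ x
        f∘g′ x = trans (cong (g ⁻¹ ∙_) (⁻¹-involutive (g ∙ x))) (⁻¹∙[∙] g x)
        shift : ∀ x → ⟨ a ⟩₃ (conj (x ⁻¹) t) ≡ normaliser ((g ∙ x) ⁻¹)
        shift x = begin
          ⟨ a ⟩₃ (conj (x ⁻¹) t)                ≡⟨ cong (λ w → ⟨ a ⟩₃ (conj (x ⁻¹) w)) (sym (conj-⁻¹-conj g t)) ⟩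
          ⟨ a ⟩₃ (conj (x ⁻¹) (conj (g ⁻¹) s))  ≡⟨ cong ⟨ a ⟩₃ (trans (conj-conj (x ⁻¹) (g ⁻¹) s) (cong (λ w → conj w s) (sym (⁻¹-anti-homo-∙ g x)))) ⟩
          ⟨ a ⟩₃ (conj ((g ∙ x) ⁻¹) s)          ≡⟨ same-subgroup ⟩
          normaliser ((g ∙ x) ⁻¹)               ∎
          where
          h = (g ∙ x) ⁻¹
          same-subgroup : ⟨ a ⟩₃ (conj h s) ≡ ⟨ a ⟩₃ (conj h a)
          same-subgroup with ⟨⟩₃-elim {a} {s} s∈
          ... | inj₁ s≡ε        = ⊥-elim (order3⇒≢ε (order3-conj g o) s≡ε)
          ... | inj₂ (inj₁ s≡a) = cong (λ w → ⟨ a ⟩₃ (conj h w)) s≡a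
          ... | inj₂ (inj₂ s≡a²) = trans (cong (λ w → ⟨ a ⟩₃ (conj h w)) s≡a²) (bool-ext
                (λ ha²∈ → A.⟨⟩₃-⊆ {conj h (a ²)} {conj h a} ha²∈ (conj-∈⟨⟩₃ h {a ²} {a} (∈-resp ⟨ a ² ⟩₃ A.²²≡ (p²∈⟨p⟩₃ (a ²)))))
                (λ ha∈ → ∈-resp ⟨ a ⟩₃ (sym (conj-² h a)) (A.⟨⟩₃-∙ ha∈ ha∈)))

    module _ {b : Fin 24} (order3-b : order3 b ≡ true) (b∉⟨a⟩ : ⟨ a ⟩₃ b ≡ false) where

      count-outside≡6 : count outside ≡ 6
      count-outside≡6 = count-constraints⇒6 (count-≤-size outside) (count-pos outside _ (outside-intro order3-b b∉⟨a⟩))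
        3∣count-outside (subst (2 ∣_) count-order3≡2+outside 2∣count-order3)
        (subst (_∣ 48) count-order3≡2+outside (divides (count normaliser) (sym (trans (*-comm (count normaliser) _) count-order3*normaliser))))

      count-normaliser≡6 : count normaliser ≡ 6
      count-normaliser≡6 = *-cancelˡ-≡ (count normaliser) 6 8 (trans (cong (_* count normaliser) (sym count-order3≡8)) count-order3*normaliser)
        where
        count-order3≡8 : count order3 ≡ 8
        count-order3≡8 = trans count-order3≡2+outside (cong (2 +_) count-outside≡6)

  -- The action of G on its four subgroups of order 3

  pattern P₀ = zero
  pattern P₁ = suc P₀
  pattern P₂ = suc P₁
  pattern P₃ = suc P₂

  opaque
    generator-of : Fin 24 → Fin 24 → Bool
    generator-of q y = (y == q) ∨ (y == q ²)

    generator-of-elim : ∀ {q y} → generator-of q y ≡ true → y ≡ q ⊎ y ≡ q ²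
    generator-of-elim {q} {y} h with ∨-elim {y == q} h
    ... | inj₁ e = inj₁ (==⇒≡ e)
    ... | inj₂ e = inj₂ (==⇒≡ e)

    generator-of-self : ∀ q → generator-of q q ≡ true
    generator-of-self q = ∨-introˡ _ (==-refl q)

    generator-of-² : ∀ q → generator-of q (q ²) ≡ true
    generator-of-² q = ∨-introʳ (q ² == q) (==-refl (q ²))

    order3∈⟨⟩₃⇒generator-of : ∀ {q y} → order3 y ≡ true → ⟨ q ⟩₃ y ≡ true → generator-of q y ≡ true
    order3∈⟨⟩₃⇒generator-of {q} {y} order3-y y∈ with ⟨⟩₃-elim {q} {y} y∈
    ... | inj₁ y≡ε        = ⊥-elim (order3⇒≢ε order3-y y≡ε)
    ... | inj₂ (inj₁ y≡q) = ∨-introˡ _ (≡⇒== y≡q)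
    ... | inj₂ (inj₂ y≡q²) = ∨-introʳ (y == q) (≡⇒== y≡q²)

    count-generator-of : ∀ {q} → order3 q ≡ true → count (generator-of q) ≡ 2
    count-generator-of order3-q = count-pair (λ q≡q² → Q.²≢ Q.p≢ε (sym q≡q²))
      where module Q = Order3 order3-q

  generator-of⇒∈ : ∀ {q y} → generator-of q y ≡ true → ⟨ q ⟩₃ y ≡ true
  generator-of⇒∈ {q} {y} h with generator-of-elim {q} {y} h
  ... | inj₁ refl = p∈⟨p⟩₃ q
  ... | inj₂ refl = p²∈⟨p⟩₃ q

  generator-of-order3 : ∀ {q y} → order3 q ≡ true → generator-of q y ≡ true → order3 y ≡ true
  generator-of-order3 {q} {y} order3-q h with generator-of-elim {q} {y} h
  ... | inj₁ refl = order3-q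
  ... | inj₂ refl = Order3.order3-² order3-q

  generator-of-disjoint : ∀ {q r y} → order3 q ≡ true → order3 r ≡ true → ⟨ q ⟩₃ r ≡ false →
    generator-of q y ≡ true → generator-of r y ≡ false
  generator-of-disjoint order3-q order3-r r∉⟨q⟩ gq = ¬-not λ gr →
    (order3⇒≢ε (generator-of-order3 order3-q gq)
      (TwoSubgroups.⟨p⟩∩⟨t⟩≡ε order3-q order3-r r∉⟨q⟩ (generator-of⇒∈ gq) (generator-of⇒∈ gr)))

  generator-of-trans : ∀ {q w y} → order3 q ≡ true → generator-of q w ≡ true → generator-of w y ≡ true →
    generator-of q y ≡ true
  generator-of-trans {q} {w} {y} order3-q gw gy with generator-of-elim {q} {w} gw | generator-of-elim {w} {y} gy
  ... | inj₁ refl | inj₁ refl = generator-of-self q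
  ... | inj₁ refl | inj₂ refl = generator-of-² q
  ... | inj₂ refl | inj₁ refl = generator-of-² q
  ... | inj₂ refl | inj₂ refl = ∈-resp (generator-of q) (sym (Order3.²²≡ order3-q)) (generator-of-self q)

  generator-of-conj : ∀ g {q y} → generator-of q y ≡ true → generator-of (conj g q) (conj g y) ≡ true
  generator-of-conj g {q} {y} h with generator-of-elim {q} {y} h
  ... | inj₁ refl = generator-of-self (conj g q)
  ... | inj₂ refl = ∈-resp (generator-of (conj g q)) (sym (conj-² g q)) (generator-of-² (conj g q))

  module Sylow {a b : Fin 24} (order3-a : order3 a ≡ true) (order3-b : order3 b ≡ true) (b∉⟨a⟩ : ⟨ a ⟩₃ b ≡ false) where
    open Outside order3-a public
    private
      module A = Order3 order3-a

    b₁ b₂ : Fin 24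
    b₁ = conj a b
    b₂ = conj a b₁

    outside-b : outside b ≡ true
    outside-b = outside-intro order3-b b∉⟨a⟩

    outside-b₁ : outside b₁ ≡ true
    outside-b₁ = conj-a-outside outside-b

    outside-b₂ : outside b₂ ≡ true
    outside-b₂ = conj-a-outside outside-b₁

    sylow : Fin 4 → Fin 24
    sylow P₀ = a
    sylow P₁ = b
    sylow P₂ = b₁
    sylow P₃ = b₂

    order3-sylow : ∀ i → order3 (sylow i) ≡ true
    order3-sylow P₀ = order3-a
    order3-sylow P₁ = order3-b
    order3-sylow P₂ = outside⇒order3 outside-b₁
    order3-sylow P₃ = outside⇒order3 outside-b₂

    private
      not-normal : ∀ {p t} → order3 p ≡ true → order3 t ≡ true → ⟨ t ⟩₃ p ≡ false → ⟨ p ⟩₃ (conj t p) ≡ false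
      not-normal order3-p order3-t p∉⟨t⟩ = TwoSubgroups.⟨p⟩-not-normal order3-p order3-t (not⟨⟩₃-sym order3-t order3-p p∉⟨t⟩)

      b₂∉⟨b⟩ : ⟨ b ⟩₃ b₂ ≡ false
      b₂∉⟨b⟩ = trans (cong ⟨ b ⟩₃ (conj-conj a a b)) (not-normal order3-b A.order3-² (¬-not λ b∈⟨a²⟩ →
        true≢false (trans (sym (A.⟨⟩₃-⊆ (p²∈⟨p⟩₃ a) b∈⟨a²⟩)) b∉⟨a⟩)))

      flip : ∀ i j → ⟨ sylow i ⟩₃ (sylow j) ≡ false → ⟨ sylow j ⟩₃ (sylow i) ≡ false
      flip i j = not⟨⟩₃-sym (order3-sylow i) (order3-sylow j)

    sylow-distinct : ∀ i j → i ≢ j → ⟨ sylow i ⟩₃ (sylow j) ≡ false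
    sylow-distinct P₀ P₀ i≢j = ⊥-elim (i≢j refl)
    sylow-distinct P₀ P₁ _   = b∉⟨a⟩
    sylow-distinct P₀ P₂ _   = outside⇒∉⟨a⟩ outside-b₁
    sylow-distinct P₀ P₃ _   = outside⇒∉⟨a⟩ outside-b₂
    sylow-distinct P₁ P₁ i≢j = ⊥-elim (i≢j refl)
    sylow-distinct P₁ P₂ _   = not-normal order3-b order3-a b∉⟨a⟩
    sylow-distinct P₁ P₃ _   = b₂∉⟨b⟩
    sylow-distinct P₂ P₂ i≢j = ⊥-elim (i≢j refl)
    sylow-distinct P₂ P₃ _   = not-normal (order3-sylow P₂) order3-a (outside⇒∉⟨a⟩ outside-b₁)
    sylow-distinct P₃ P₃ i≢j = ⊥-elim (i≢j refl)
    sylow-distinct P₁ P₀ _   = flip P₀ P₁ (sylow-distinct P₀ P₁ λ ())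
    sylow-distinct P₂ P₀ _   = flip P₀ P₂ (sylow-distinct P₀ P₂ λ ())
    sylow-distinct P₃ P₀ _   = flip P₀ P₃ (sylow-distinct P₀ P₃ λ ())
    sylow-distinct P₂ P₁ _   = flip P₁ P₂ (sylow-distinct P₁ P₂ λ ())
    sylow-distinct P₃ P₁ _   = flip P₁ P₃ (sylow-distinct P₁ P₃ λ ())
    sylow-distinct P₃ P₂ _   = flip P₂ P₃ (sylow-distinct P₂ P₃ λ ())

    private
      generator-of-outside : ∀ {q y} → outside q ≡ true → generator-of q y ≡ true → outside y ≡ true
      generator-of-outside {q} {y} q-out gy = outside-intro (generator-of-order3 (outside⇒order3 q-out) gy)
        (¬-not λ y∈⟨a⟩ → true≢false (trans (sym (A.⟨⟩₃-⊆ y∈⟨a⟩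
          (Order3.⟨⟩₃-generator (outside⇒order3 q-out) (generator-of⇒∈ gy) (order3⇒≢ε (generator-of-order3 (outside⇒order3 q-out) gy)))))
          (outside⇒∉⟨a⟩ q-out)))

      covered : Fin 24 → Bool
      covered y = generator-of b y ∨ (generator-of b₁ y ∨ generator-of b₂ y)

      disjoint : ∀ i j → i ≢ j → ∀ y → generator-of (sylow i) y ≡ true → generator-of (sylow j) y ≡ false
      disjoint i j i≢j y = generator-of-disjoint (order3-sylow i) (order3-sylow j) (sylow-distinct i j i≢j)

      count-covered : count covered ≡ 6
      count-covered = trans
        (count-∨-disjoint (generator-of b) _ (λ y gy → ¬-not λ h →
          [ (λ g₁ → true≢false (trans (sym g₁) (disjoint P₁ P₂ (λ ()) y gy)))
          , (λ g₂ → true≢false (trans (sym g₂) (disjoint P₁ P₃ (λ ()) y gy))) ] (∨-elim h)))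
        (cong₂ _+_ (count-generator-of order3-b)
          (trans (count-∨-disjoint (generator-of b₁) (generator-of b₂) (disjoint P₂ P₃ (λ ())))
                 (cong₂ _+_ (count-generator-of (order3-sylow P₂)) (count-generator-of (order3-sylow P₃)))))

      outside⇒covered : ∀ y → outside y ≡ true → covered y ≡ true
      outside⇒covered = ⊆∧count-≥⇒⊇ covered outside covered⇒outside
        (≤-reflexive (trans (count-outside≡6 order3-b b∉⟨a⟩) (sym count-covered)))
        where
        covered⇒outside : ∀ y → covered y ≡ true → outside y ≡ true
        covered⇒outside y h with ∨-elim {generator-of b y} h
        ... | inj₁ g = generator-of-outside outside-b g
        ... | inj₂ h′ with ∨-elim {generator-of b₁ y} h′
        ...   | inj₁ g = generator-of-outside outside-b₁ g
        ...   | inj₂ g = generator-of-outside outside-b₂ g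

    sylow-cover : ∀ y → order3 y ≡ true → ∃ λ i → generator-of (sylow i) y ≡ true
    sylow-cover y order3-y = by-cases (⟨ a ⟩₃ y) refl
      where
      from-covered : covered y ≡ true → ∃ λ i → generator-of (sylow i) y ≡ true
      from-covered h = [ (λ g → P₁ , g)
                       , (λ h′ → [ (λ g → P₂ , g) , (λ g → P₃ , g) ] (∨-elim {generator-of b₁ y} h′))
                       ] (∨-elim {generator-of b y} h)
      by-cases : ∀ c → ⟨ a ⟩₃ y ≡ c → ∃ λ i → generator-of (sylow i) y ≡ true
      by-cases true  y∈ = P₀ , order3∈⟨⟩₃⇒generator-of order3-y y∈
      by-cases false y∉ = from-covered (outside⇒covered y (outside-intro order3-y y∉))

    sylow-unique : ∀ i j {y} → generator-of (sylow i) y ≡ true → generator-of (sylow j) y ≡ true → i ≡ j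
    sylow-unique i j {y} gi gj with i ≟ᶠ j
    ... | yes i≡j = i≡j
    ... | no  i≢j = ⊥-elim (true≢false (trans (sym gj) (disjoint i j i≢j y gi)))

    opaque
      act : Fin 24 → Fin 4 → Fin 4
      act y i = proj₁ (sylow-cover (conj y (sylow i)) (order3-conj y (order3-sylow i)))

      act-spec : ∀ y i → generator-of (sylow (act y i)) (conj y (sylow i)) ≡ true
      act-spec y i = proj₂ (sylow-cover (conj y (sylow i)) (order3-conj y (order3-sylow i)))

    act-unique : ∀ y i j → generator-of (sylow j) (conj y (sylow i)) ≡ true → act y i ≡ j
    act-unique y i j h = sylow-unique (act y i) j (act-spec y i) h

    act-∙ : ∀ y z i → act (y ∙ z) i ≡ act y (act z i)
    act-∙ y z i = act-unique (y ∙ z) i (act y (act z i))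
      (∈-resp (generator-of (sylow (act y (act z i)))) (conj-conj y z (sylow i))
        (generator-of-trans (order3-sylow (act y (act z i))) (act-spec y (act z i)) (generator-of-conj y (act-spec z i))))

    act-ε : ∀ i → act ε i ≡ i
    act-ε i = act-unique ε i i (∈-resp (generator-of (sylow i)) (sym (conj-by-ε (sylow i))) (generator-of-self (sylow i)))

    act-a : act a P₀ ≡ P₀ × act a P₁ ≡ P₂ ×
            act a P₂ ≡ P₃ × act a P₃ ≡ P₁
    act-a = act-unique a P₀ P₀ (∈-resp (generator-of a) (sym (comm⇒conj≡ a a refl)) (generator-of-self a))
          , act-unique a P₁ P₂ (generator-of-self b₁)
          , act-unique a P₂ P₃ (generator-of-self b₂)
          , act-unique a P₃ P₁ (∈-resp (generator-of b) (sym (conj-a³≡id b)) (generator-of-self b))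

    act-b-fixes-1 : act b P₁ ≡ P₁
    act-b-fixes-1 = act-unique b P₁ P₁ (∈-resp (generator-of b) (sym (comm⇒conj≡ b b refl)) (generator-of-self b))

    act-b-moves-0 : act b P₀ ≢ P₀
    act-b-moves-0 eq = true≢false (trans (sym (generator-of⇒∈ (subst (λ i → generator-of (sylow i) (conj b a) ≡ true) eq (act-spec b P₀))))
      (not-normal order3-a order3-b (not⟨⟩₃-sym order3-a order3-b b∉⟨a⟩)))

  -- Generators satisfying the relations of SL₂(𝔽₃)

  Rotates-0-2-3 : (Fin 4 → Fin 4) → Set
  Rotates-0-2-3 f = f P₀ ≡ P₂ × f P₂ ≡ P₃ × f P₃ ≡ P₀

  three-cycle : (f : Fin 4 → Fin 4) → f P₁ ≡ P₁ → f P₀ ≢ P₀ → (∀ i → f (f (f i)) ≡ i) →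
    Rotates-0-2-3 f ⊎ Rotates-0-2-3 (λ i → f (f i))
  three-cycle f f₁ f₀≢0 f³≡id = from-f₀ (f P₀) refl
    where
    cube : ∀ {u v w} → f P₀ ≡ u → f u ≡ v → f v ≡ w → w ≡ P₀
    cube e₁ e₂ e₃ = trans (sym (trans (cong (λ x → f (f x)) e₁) (trans (cong f e₂) e₃))) (f³≡id P₀)
    from-f₀ : ∀ u → f P₀ ≡ u → Rotates-0-2-3 f ⊎ Rotates-0-2-3 (λ i → f (f i))
    from-f₀ P₀                   e = ⊥-elim (f₀≢0 e)
    from-f₀ P₁             e = case cube e f₁ f₁ of λ ()
    from-f₀ P₂       e = from-f₂ (f P₂) refl
      where
      from-f₂ : ∀ v → f P₂ ≡ v → Rotates-0-2-3 f ⊎ Rotates-0-2-3 (λ i → f (f i))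
      from-f₂ P₀                   e₂ = case cube e e₂ e of λ ()
      from-f₂ P₁             e₂ = case cube e e₂ f₁ of λ ()
      from-f₂ P₂       e₂ = case cube e e₂ e₂ of λ ()
      from-f₂ P₃ e₂ = inj₁ (e , e₂ , cube e e₂ refl)
    from-f₀ P₃ e = from-f₃ (f P₃) refl
      where
      from-f₃ : ∀ v → f P₃ ≡ v → Rotates-0-2-3 f ⊎ Rotates-0-2-3 (λ i → f (f i))
      from-f₃ P₀                   e₃ = case cube e e₃ e of λ ()
      from-f₃ P₁             e₃ = case cube e e₃ f₁ of λ ()
      from-f₃ P₂       e₃ = inj₂ (trans (cong f e) e₃ , trans (cong f (cube e e₃ refl)) e , trans (cong f e₃) (cube e e₃ refl))
      from-f₃ P₃ e₃ = case cube e e₃ e₃ of λ ()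

  module Generators {a b : Fin 24} (order3-a : order3 a ≡ true) (order3-b : order3 b ≡ true) (b∉⟨a⟩ : ⟨ a ⟩₃ b ≡ false) where
    open Sylow order3-a order3-b b∉⟨a⟩
    private
      module A = Order3 order3-a

    InKernel : Fin 24 → Set
    InKernel y = ∀ i → act y i ≡ i

    kernel-∙ : ∀ {y z} → InKernel y → InKernel z → InKernel (y ∙ z)
    kernel-∙ {y} {z} ky kz i = trans (act-∙ y z i) (trans (cong (act y) (kz i)) (ky i))

    kernel-conj : ∀ g {k} → InKernel k → InKernel (conj g k)
    kernel-conj g {k} kk i = begin
      act (g ∙ k ∙ g ⁻¹) i          ≡⟨ trans (act-∙ (g ∙ k) (g ⁻¹) i) (act-∙ g k _) ⟩
      act g (act k (act (g ⁻¹) i))  ≡⟨ cong (act g) (kk _) ⟩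
      act g (act (g ⁻¹) i)          ≡⟨ sym (act-∙ g (g ⁻¹) i) ⟩
      act (g ∙ g ⁻¹) i              ≡⟨ cong (λ w → act w i) (inverseʳ g) ⟩
      act ε i                       ≡⟨ act-ε i ⟩
      i                             ∎

    normaliser-subgroup : IsSubgroup normaliser
    normaliser-subgroup = record
      { ε∈  = ∈-resp ⟨ a ⟩₃ (sym (conj-by-ε a)) (p∈⟨p⟩₃ a)
      ; ∙∈  = λ {y} {z} y∈ z∈ → ∈-resp ⟨ a ⟩₃ (conj-conj y z a) (conj-⟨a⟩ y∈ z∈)
      ; ⁻¹∈ = λ {y} y∈ → normaliser-⁻¹ y y∈
      }
      where
      conj-⟨a⟩ : ∀ {y c} → normaliser y ≡ true → ⟨ a ⟩₃ c ≡ true → ⟨ a ⟩₃ (conj y c) ≡ true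
      conj-⟨a⟩ {y} {c} y∈ c∈ = A.⟨⟩₃-⊆ {conj y a} {conj y c} y∈ (conj-∈⟨⟩₃ y {a} {c} c∈)
      normaliser-⁻¹ : ∀ y → normaliser y ≡ true → normaliser (y ⁻¹) ≡ true
      normaliser-⁻¹ y y∈ = subst (λ p → ⟨ p ⟩₃ (conj (y ⁻¹) a) ≡ true) (conj-⁻¹-conj y a)
        (conj-∈⟨⟩₃ (y ⁻¹) {conj y a} {a} (A.⟨⟩₃-generator {conj y a} y∈ (order3⇒≢ε (order3-conj y order3-a))))

    kernel⊆normaliser : ∀ {y} → InKernel y → normaliser y ≡ true
    kernel⊆normaliser {y} ky = generator-of⇒∈ (subst (λ i → generator-of (sylow i) (conj y a) ≡ true) (ky P₀) (act-spec y P₀))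

    kernel∩⟨a⟩≡ε : ∀ {w} → InKernel w → ⟨ a ⟩₃ w ≡ true → w ≡ ε
    kernel∩⟨a⟩≡ε {w} kw w∈ with ⟨⟩₃-elim {a} {w} w∈
    ... | inj₁ w≡ε        = w≡ε
    ... | inj₂ (inj₁ refl) = case trans (sym (proj₁ (proj₂ act-a))) (kw P₁) of λ ()
    ... | inj₂ (inj₂ refl) = case trans (sym (trans (act-∙ a a P₁) (trans (cong (act a) (proj₁ (proj₂ act-a))) (proj₁ (proj₂ (proj₂ act-a))))))
                                        (kw P₁) of λ ()

    kernel-⁻¹ : ∀ {y} → InKernel y → InKernel (y ⁻¹)
    kernel-⁻¹ {y} ky i = begin
      act (y ⁻¹) i          ≡⟨ cong (act (y ⁻¹)) (sym (ky i)) ⟩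
      act (y ⁻¹) (act y i)  ≡⟨ sym (act-∙ (y ⁻¹) y i) ⟩
      act (y ⁻¹ ∙ y) i      ≡⟨ cong (λ w → act w i) (inverseˡ y) ⟩
      act ε i               ≡⟨ act-ε i ⟩
      i                     ∎

    -- Two nontrivial kernel elements would give nine elements k ⟨a⟩ in the normaliser of ⟨a⟩, which has six.
    kernel-unique : ∀ {k k′} → InKernel k → InKernel k′ → k ≢ ε → k′ ≢ ε → k ≡ k′
    kernel-unique {k} {k′} kk kk′ k≢ε k′≢ε = ≡-stable λ k≢k′ → 9≰6
      (subst₂ _≤_ (count-image₂-injective cosets (cosets-injective k≢k′)) (count-normaliser≡6 order3-b b∉⟨a⟩)
                  (count-mono cosets⊆normaliser))
      where
      9≰6 : 9 ≤ 6 → ⊥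
      9≰6 (s≤s (s≤s (s≤s (s≤s (s≤s (s≤s ()))))))
      element : Fin 3 → Fin 24
      element zero             = ε
      element (suc zero)       = k
      element (suc (suc zero)) = k′
      element-in-kernel : ∀ r → InKernel (element r)
      element-in-kernel zero             = act-ε
      element-in-kernel (suc zero)       = kk
      element-in-kernel (suc (suc zero)) = kk′
      element-injective : k ≢ k′ → ∀ r s → element r ≡ element s → r ≡ s
      element-injective _    zero             zero             _  = refl
      element-injective _    zero             (suc zero)       eq = ⊥-elim (k≢ε (sym eq))
      element-injective _    zero             (suc (suc zero)) eq = ⊥-elim (k′≢ε (sym eq))
      element-injective _    (suc zero)       zero             eq = ⊥-elim (k≢ε eq)
      element-injective _    (suc zero)       (suc zero)       _  = refl
      element-injective k≢k′ (suc zero)       (suc (suc zero)) eq = ⊥-elim (k≢k′ eq)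
      element-injective _    (suc (suc zero)) zero             eq = ⊥-elim (k′≢ε eq)
      element-injective k≢k′ (suc (suc zero)) (suc zero)       eq = ⊥-elim (k≢k′ (sym eq))
      element-injective _    (suc (suc zero)) (suc (suc zero)) _  = refl
      cosets : Fin 3 → Fin 3 → Fin 24
      cosets r i = element r ∙ power₃ a i
      cosets-injective : k ≢ k′ → ∀ r i s j → cosets r i ≡ cosets s j → r ≡ s × i ≡ j
      cosets-injective k≢k′ r i s j eq = r≡s , A.power₃-injective i j (∙-cancelˡ (element r) _ _ (trans eq (cong (λ e → e ∙ power₃ a j) (cong element (sym r≡s)))))
        where
        meet : element s ⁻¹ ∙ element r ≡ ε
        meet = kernel∩⟨a⟩≡ε (kernel-∙ (kernel-⁻¹ (element-in-kernel s)) (element-in-kernel r))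
          (∈-resp ⟨ a ⟩₃ (sym (∙≡∙⇒⁻¹∙≡∙⁻¹ eq)) (A.⟨⟩₃-∙ (power₃∈⟨⟩₃ a j) (A.⟨⟩₃-⁻¹ (power₃∈⟨⟩₃ a i))))
        r≡s : r ≡ s
        r≡s = element-injective k≢k′ r s (∙-cancelˡ (element s ⁻¹) _ _ (trans meet (sym (inverseˡ _))))
      cosets⊆normaliser : ∀ y → image₂ cosets y ≡ true → normaliser y ≡ true
      cosets⊆normaliser y y∈ with image₂-elim cosets y∈
      ... | r , i , refl = IsSubgroup.∙∈ normaliser-subgroup (kernel⊆normaliser (element-in-kernel r)) (power₃-normalises i)
        where
        power₃-normalises : ∀ i → normaliser (power₃ a i) ≡ true
        power₃-normalises i = ∈-resp ⟨ a ⟩₃ (sym (comm⇒conj≡ (power₃ a i) a (⟨⟩₃-comm (power₃∈⟨⟩₃ a i) (p∈⟨p⟩₃ a)))) (p∈⟨p⟩₃ a)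

    kernel-central : ∀ {k} → InKernel k → ∀ y → y ∙ k ≡ k ∙ y
    kernel-central {k} kk y = conj≡⇒comm y k (≡-stable λ yky≢k →
      let k≢ε : k ≢ ε
          k≢ε k≡ε = yky≢k (trans (cong (conj y) k≡ε) (trans (conj-ε y) (sym k≡ε)))
      in yky≢k (kernel-unique (kernel-conj y kk) kk (λ yky≡ε → k≢ε (conj≡ε⇒≡ε y yky≡ε)) k≢ε))

    kernel-involution : ∀ {k} → InKernel k → k ² ≡ ε
    kernel-involution {k} kk = ≡-stable λ k²≢ε →
      let k≢ε : k ≢ ε
          k≢ε k≡ε = k²≢ε (trans (cong _² k≡ε) (identityˡ ε))
      in k≢ε (∙-cancelˡ k k ε (trans (kernel-unique (kernel-∙ kk kk) kk k²≢ε k≢ε) (sym (identityʳ k))))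

    act-b³ : ∀ i → act b (act b (act b i)) ≡ i
    act-b³ i = begin
      act b (act b (act b i))  ≡⟨ sym (trans (act-∙ b (b ∙ b) i) (cong (act b) (act-∙ b b i))) ⟩
      act (b ³) i              ≡⟨ cong (λ w → act w i) (order3⇒³≡ε order3-b) ⟩
      act ε i                  ≡⟨ act-ε i ⟩
      i                        ∎

    rotation : ∃ λ c → Rotates-0-2-3 (act c) × act c P₁ ≡ P₁
    rotation = [ (λ r → b , r , act-b-fixes-1) , (λ r → b ∙ b , via-b² r , b²-fixes-1) ]′
                 (three-cycle (act b) act-b-fixes-1 act-b-moves-0 act-b³)
      where
      via-b² : Rotates-0-2-3 (λ i → act b (act b i)) → Rotates-0-2-3 (act (b ∙ b))
      via-b² (r₀ , r₂ , r₃) = trans (act-∙ b b P₀) r₀ , trans (act-∙ b b P₂) r₂ , trans (act-∙ b b P₃) r₃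
      b²-fixes-1 : act (b ∙ b) P₁ ≡ P₁
      b²-fixes-1 = trans (act-∙ b b P₁) (trans (cong (act b) act-b-fixes-1) act-b-fixes-1)

    -- x acts on the four subgroups as (0 3)(1 2), and a ∙ x as the 3-cycle (0 1 3).
    x : Fin 24
    x = a ∙ proj₁ rotation

    act-x : act x P₀ ≡ P₃ × act x P₁ ≡ P₂ × act x P₂ ≡ P₁ × act x P₃ ≡ P₀
    act-x = step P₀ c₀ a₂ , step P₁ c₁ a₁ , step P₂ c₂ a₃ , step P₃ c₃ a₀
      where
      c = proj₁ rotation
      c₀ = proj₁ (proj₁ (proj₂ rotation))
      c₂ = proj₁ (proj₂ (proj₁ (proj₂ rotation)))
      c₃ = proj₂ (proj₂ (proj₁ (proj₂ rotation)))
      c₁ = proj₂ (proj₂ rotation)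
      a₀ = proj₁ act-a
      a₁ = proj₁ (proj₂ act-a)
      a₂ = proj₁ (proj₂ (proj₂ act-a))
      a₃ = proj₂ (proj₂ (proj₂ act-a))
      step : ∀ i {j k} → act c i ≡ j → act a j ≡ k → act x i ≡ k
      step i cᵢ aⱼ = trans (act-∙ a c i) (trans (cong (act a) cᵢ) aⱼ)

    kernel-x² : InKernel (x ²)
    kernel-x² P₀ = trans (act-∙ x x P₀) (trans (cong (act x) (proj₁ act-x)) (proj₂ (proj₂ (proj₂ act-x))))
    kernel-x² P₁ = trans (act-∙ x x P₁) (trans (cong (act x) (proj₁ (proj₂ act-x))) (proj₁ (proj₂ (proj₂ act-x))))
    kernel-x² P₂ = trans (act-∙ x x P₂) (trans (cong (act x) (proj₁ (proj₂ (proj₂ act-x)))) (proj₁ (proj₂ act-x)))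
    kernel-x² P₃ = trans (act-∙ x x P₃) (trans (cong (act x) (proj₂ (proj₂ (proj₂ act-x)))) (proj₁ act-x))

    kernel-[ax]³ : InKernel ((a ∙ x) ³)
    kernel-[ax]³ i = trans (act-∙ (a ∙ x) _ i) (trans (cong (act (a ∙ x)) (act-∙ (a ∙ x) (a ∙ x) i)) (cycle i))
      where
      ax : ∀ {i j k} → act x i ≡ j → act a j ≡ k → act (a ∙ x) i ≡ k
      ax {i} xᵢ aⱼ = trans (act-∙ a x i) (trans (cong (act a) xᵢ) aⱼ)
      ax₀ = ax (proj₁ act-x) (proj₂ (proj₂ (proj₂ act-a)))
      ax₁ = ax (proj₁ (proj₂ act-x)) (proj₁ (proj₂ (proj₂ act-a)))
      ax₂ = ax (proj₁ (proj₂ (proj₂ act-x))) (proj₁ (proj₂ act-a))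
      ax₃ = ax (proj₂ (proj₂ (proj₂ act-x))) (proj₁ act-a)
      cycle : ∀ i → act (a ∙ x) (act (a ∙ x) (act (a ∙ x) i)) ≡ i
      cycle P₀ = trans (cong (λ j → act (a ∙ x) (act (a ∙ x) j)) ax₀) (trans (cong (act (a ∙ x)) ax₁) ax₃)
      cycle P₁ = trans (cong (λ j → act (a ∙ x) (act (a ∙ x) j)) ax₁) (trans (cong (act (a ∙ x)) ax₃) ax₀)
      cycle P₂ = trans (cong (λ j → act (a ∙ x) (act (a ∙ x) j)) ax₂) (trans (cong (act (a ∙ x)) ax₂) ax₂)
      cycle P₃ = trans (cong (λ j → act (a ∙ x) (act (a ∙ x) j)) ax₃) (trans (cong (act (a ∙ x)) ax₀) ax₁)

    -- Correcting x by the central element (a ∙ x)³, of order at most 2, makes (a ∙ x′)³ trivial.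
    w x′ : Fin 24
    w = (a ∙ x) ³
    x′ = x ∙ w

    w-central : ∀ y → y ∙ w ≡ w ∙ y
    w-central = kernel-central kernel-[ax]³

    w²≡ε : w ² ≡ ε
    w²≡ε = kernel-involution kernel-[ax]³

    x′²≡x² : x′ ² ≡ x ²
    x′²≡x² = trans (²-∙-comm x w (w-central x)) (trans (cong (x ² ∙_) w²≡ε) (identityʳ _))

    [ax′]³≡ε : (a ∙ x′) ³ ≡ ε
    [ax′]³≡ε = begin
      (a ∙ (x ∙ w)) ³    ≡⟨ cong _³ (sym (assoc a x w)) ⟩
      (a ∙ x ∙ w) ³      ≡⟨ ³-∙-comm (a ∙ x) w (w-central (a ∙ x)) ⟩
      w ∙ w ³            ≡⟨ cong (λ v → w ∙ (w ∙ v)) w²≡ε ⟩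
      w ∙ (w ∙ ε)        ≡⟨ cong (w ∙_) (identityʳ w) ⟩
      w ²                ≡⟨ w²≡ε ⟩
      ε                  ∎

    x′⁴≡ε : (x′ ²) ² ≡ ε
    x′⁴≡ε = trans (cong _² x′²≡x²) (kernel-involution kernel-x²)

    x′²a≡ax′² : x′ ² ∙ a ≡ a ∙ x′ ²
    x′²a≡ax′² = trans (cong (_∙ a) x′²≡x²) (trans (sym (kernel-central kernel-x² a)) (cong (a ∙_) (sym x′²≡x²)))

    conj-x′-a∉⟨a⟩ : ⟨ a ⟩₃ (conj x′ a) ≡ false
    conj-x′-a∉⟨a⟩ = ¬-not λ x′ax′⁻¹∈ → case trans (sym act-x′₀) (act-unique x′ P₀ P₀
      (order3∈⟨⟩₃⇒generator-of (order3-conj x′ order3-a) x′ax′⁻¹∈)) of λ ()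
      where
      act-x′₀ : act x′ P₀ ≡ P₃
      act-x′₀ = trans (act-∙ x w P₀) (trans (cong (act x) (kernel-[ax]³ P₀)) (proj₁ act-x))

    sl₂-generators : SL₂Generators G
    sl₂-generators = record
      { generator = λ { α → a ; ξ → x′ }
      ; α³≡ε      = order3⇒³≡ε order3-a
      ; [αξ]³≡ε   = [ax′]³≡ε
      ; ξ⁴≡ε      = x′⁴≡ε
      ; ξ²α≡αξ²   = x′²a≡ax′²
      ; generate  = λ S a∈ x′∈ → let open IsSubgroup S in
          TwoSubgroups.generate order3-a (order3-conj x′ order3-a) conj-x′-a∉⟨a⟩ S a∈ (∙∈ (∙∈ x′∈ a∈) (⁻¹∈ x′∈))
      }

  opaque
    sl₂-generators : SL₂Generators G
    sl₂-generators with ∃order3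
    ... | a , order3-a with ∃order3∉⟨⟩₃ order3-a
    ...   | b , order3-b , b∉⟨a⟩ = Generators.sl₂-generators order3-a order3-b b∉⟨a⟩

open import Level using (Level)
open import Data.Nat.Base using (ℕ; zero; suc)
open import Data.Fin.Base using (Fin)
open import Data.Product using (_,_; proj₁; proj₂)
open import Relation.Binary.PropositionalEquality as ≡ using (_≡_)
open import Algebra.Bundles using (Group)
open import Function.Bundles using (Bijection)
import Relation.Binary.Reasoning.Setoid as SetoidReasoning
open import Defs
open Presentation using (SL₂Generators; module Isomorphism)

module Transport {c ℓ : Level} (G : Group c ℓ) {n : ℕ} (bij : Bijection (Group.setoid G) (≡.setoid (Fin n))) where
  open Group G
  open Bijection bij using (to; injective; surjective) renaming (cong to to-cong)
  open SetoidReasoning setoid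

  from : Fin n → Carrier
  from y = proj₁ (surjective y)

  to-from : ∀ y → to (from y) ≡ y
  to-from y = proj₂ (surjective y) refl

  from-to : ∀ x → from (to x) ≈ x
  from-to x = injective (to-from (to x))

  fin-group : FinGroup n
  fin-group = record
    { _∙_     = λ x y → to (from x ∙ from y)
    ; ε       = to ε
    ; _⁻¹     = λ x → to (from x ⁻¹)
    ; isGroup = record
      { isMonoid = record
        { isSemigroup = record
          { isMagma = record { isEquivalence = ≡.isEquivalence ; ∙-cong = ≡.cong₂ (λ x y → to (from x ∙ from y)) }
          ; assoc   = λ x y z → to-cong (begin
              from (to (from x ∙ from y)) ∙ from z  ≈⟨ ∙-congʳ (from-to _) ⟩
              (from x ∙ from y) ∙ from z            ≈⟨ assoc _ _ _ ⟩
              from x ∙ (from y ∙ from z)            ≈⟨ ∙-congˡ (sym (from-to _)) ⟩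
              from x ∙ from (to (from y ∙ from z))  ∎)
          }
        ; identity = (λ x → ≡.trans (to-cong (trans (∙-congʳ (from-to ε)) (identityˡ _))) (to-from x))
                   , (λ x → ≡.trans (to-cong (trans (∙-congˡ (from-to ε)) (identityʳ _))) (to-from x))
        }
      ; inverse = (λ x → to-cong (trans (∙-congʳ (from-to _)) (inverseˡ _)))
                , (λ x → to-cong (trans (∙-congˡ (from-to _)) (inverseʳ _)))
      ; ⁻¹-cong = ≡.cong (λ x → to (from x ⁻¹))
      }
    }

  open FinGroup fin-group using () renaming (_∙_ to _⊙_; _⁻¹ to _⁻¹′; group to group′)

  to-∙ : ∀ x y → to (x ∙ y) ≡ to x ⊙ to y
  to-∙ x y = to-cong (∙-cong (sym (from-to x)) (sym (from-to y)))

  to-⁻¹ : ∀ x → to (x ⁻¹) ≡ to x ⁻¹′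
  to-⁻¹ x = to-cong (⁻¹-cong (sym (from-to x)))

  to-pow : ∀ g m → to (pow G g m) ≡ pow group′ (to g) m
  to-pow g zero    = ≡.refl
  to-pow g (suc m) = ≡.trans (to-∙ g (pow G g m)) (≡.cong (to g ⊙_) (to-pow g m))

  to-odd-order : ∀ {g} → HasOddOrder G g → HasOddOrder group′ (to g)
  to-odd-order {g} (m , (m>0 , gᵐ≈ε , minimal) , odd) =
    m , (m>0 , ≡.trans (≡.sym (to-pow g m)) (to-cong gᵐ≈ε) ,
         λ k k>0 k<m gᵏ≡ε → minimal k k>0 k<m (injective (≡.trans (to-pow g k) gᵏ≡ε))) , odd

  to-generated : GeneratedBy G (HasOddOrder G) → GeneratedBy group′ (HasOddOrder group′)
  to-generated generated y = ≡.subst (⟨_⟩ group′ (HasOddOrder group′)) (to-from y) (go (generated (from y)))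
    where
    go : ∀ {g} → ⟨_⟩ G (HasOddOrder G) g → ⟨_⟩ group′ (HasOddOrder group′) (to g)
    go (gen odd)   = gen (to-odd-order odd)
    go unit        = unit
    go (mul p q)   = resp (≡.sym (to-∙ _ _)) (mul (go p) (go q))
    go (inv p)     = resp (≡.sym (to-⁻¹ _)) (inv (go p))
    go (resp eq p) = resp (to-cong eq) (go p)

isomorphic-to-SL₂ : {c ℓ : Level} (G : Group c ℓ) (bij : HasOrderℕ G 24) →
  SL₂Generators (Transport.fin-group G bij) → IsomorphicTo G binaryTetrahedral
isomorphic-to-SL₂ G bij gens = (λ g → ψ (to g)) , record
  { isGroupMonomorphism = record
    { isGroupHomomorphism = record
      { isMonoidHomomorphism = record
        { isMagmaHomomorphism = record
          { isRelHomomorphism = record { cong = λ eq → ≡.cong (λ y → proj₁ (ψ y)) (to-cong eq) }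
          ; homo = λ x y → ≡.trans (≡.cong (λ y → proj₁ (ψ y)) (to-∙ x y)) (ψ-∙ (to x) (to y))
          }
        ; ε-homo = ψ-ε
        }
      ; ⁻¹-homo = λ x → ≡.trans (≡.cong (λ y → proj₁ (ψ y)) (to-⁻¹ x)) (ψ-⁻¹ (to x))
      }
    ; injective = λ eq → injective (ψ-injective _ _ eq)
    }
  ; surjective = λ (m , det≡1) → from (φ m) , λ {g} g≈ → ψ-unique (to g) m det≡1 (≡.sym (≡.trans (to-cong g≈) (to-from (φ m))))
  }
  where
  open Transport G bij
  open Bijection bij using (to; injective) renaming (cong to to-cong)
  open Isomorphism gens

proposition5p15 : {c ℓ : Level} (G : Group c ℓ) →
    HasOrderℕ G 24 →
    GeneratedBy G (HasOddOrder G) →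
    IsomorphicTo G binaryTetrahedral
proposition5p15 G bij generated =
  isomorphic-to-SL₂ G bij (Order24.sl₂-generators fin-group (to-generated generated))
  where open Transport G bij
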